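{- Let $m\geqslant 3$, $n\geqslant 3$, $M\geqslant m$, $N\geqslant n$ be odd integers and let $X$ be a partial bicentrally balanced $C_4$-face-magic labeling on the $m\times n$ subgrid of $\mathcal{P}_{M,N}$. If $r$ is an odd positive integer with $mr\leqslant M$, then $\mathrm{HASC}^r(X)$ is a partial bicentrally balanced $C_4$-face-magic labeling on the $mr\times n$ subgrid of $\mathcal{P}_{M,N}$. Similarly, if $r$ is an odd positive integer with $nr\leqslant N$, then $\mathrm{VASC}^r(X)$ is a partial bicentrally balanced $C_4$-face-magic labeling on the $m\times nr$ subgrid of $\mathcal{P}_{M,N}$.
   Context: For odd $p,q\geqslant 3$ with $p\leqslant M$, $q\leqslant N$, write $p=2p_0+1$, $q=2q_0+1$, $p_0^{+}=p_0+1$, $q_0^{+}=q_0+1$, $\mathrm{Grid}(p,q)=\{(i,j):1\leqslant i\leqslant p,1\leqslant j\leqslant q\}$, with planar grid graph $P_p\times P_q$ whose 4-cycle faces are $\{(i,j),(i+1,j),(i,j+1),(i+1,j+1)\}$. A labeling $X=\{x_{i,j}:(i,j)\in\mathrm{Grid}(p,q)\}$ is a partial bicentrally balanced $C_4$-face-magic labeling on the $p\times q$ subgrid of $\mathcal{P}_{M,N}$ if: (1) every 4-cycle face of $P_p\times P_q$ has label sum $2MN+3$; (2) $\{x_{i,j}: i+j\text{ even}\}=\{1,\ldots,\tfrac12 pq+\tfrac12\}$; (3) $\{x_{i,j}: i+j\text{ odd}\}=\{MN-\tfrac12 pq+\tfrac32,\ldots,MN\}$; (4) $x_{i,j}+x_{p+1-i,q+1-j}=\tfrac12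 pq+\tfrac32$ if $i+j$ even; (5) $x_{i,j}+x_{p+1-i,q+1-j}=2MN-\tfrac12 pq+\tfrac32$ if $i+j$ odd; (6) $x_{i,q_0^{+}}<x_{i+2,q_0^{+}}$ for $1\leqslant i\leqslant p-2$ with $i+q_0^{+}$ even, $x_{i,q_0^{+}}>x_{i+2,q_0^{+}}$ for $1\leqslant i\leqslant p-2$ with $i+q_0^{+}$ odd, $x_{p_0^{+},j}<x_{p_0^{+},j+2}$ for $1\leqslant j\leqslant q-2$ with $p_0^{+}+j$ even, and $x_{p_0^{+},j}>x_{p_0^{+},j+2}$ for $1\leqslant j\leqslant q-2$ with $p_0^{+}+j$ odd. For $X$ on $\mathrm{Grid}(m,n)$ and odd $r=2r_0+1\geqslant 1$: $\mathrm{HASC}^r(X)=\{y_{i,j}:(i,j)\in\mathrm{Grid}(mr,n)\}$ is defined for all $(i,j)\in\mathrm{Grid}(m,n)$ by: $y_{(2k-1)m+i,j}=MN-x_{i,j}+(k-\tfrac12)mn+\tfrac32$ if $1\leqslant k\leqslant r_0$ and $i+j$ odd; $y_{(2k-1)m+i,j}=MN-x_{i,j}-(k-\tfrac12)mn+\tfrac32$ if $1\leqslant k\leqslant r_0$ and $i+j$ even; $y_{2km+i,j}=x_{i,j}-kmn$ if $0\leqslant k\leqslant r_0$ and $i+j$ odd; $y_{2km+i,j}=x_{i,j}+kmn$ if $0\leqslant k\leqslant r_0$ and $i+j$ even. $\mathrm{VASC}^r(X)=\{y_{i,j}:(i,j)\in\mathrm{Grid}(m,nr)\}$ is defined by the same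 formulas with the shifts applied to the second coordinate: $y_{i,(2k-1)n+j}$ and $y_{i,2kn+j}$ in place of $y_{(2k-1)m+i,j}$ and $y_{2km+i,j}$ (with the same right-hand sides). For $r=1$ both equal $X$. -}

module Defs where

open import Data.Nat as ℕ using (ℕ; suc; _≤_; _%_; _/_)
open import Data.Integer as ℤ using (ℤ; +_; _+_; _-_; _*_)
open import Data.Product using (_×_; ∃; ∃-syntax)
open import Relation.Binary.PropositionalEquality using (_≡_)

-- A labeling of grid positions (i , j) (1-based) by integers.
-- Only the values on the relevant grid matter.
Label : Set
Label = ℕ → ℕ → ℤ

IsEven : ℕ → Set
IsEven n = n % 2 ≡ 0

IsOdd : ℕ → Set
IsOdd n = n % 2 ≡ 1

InGrid : ℕ → ℕ → ℕ → ℕ → Set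
InGrid p q i j = (1 ≤ i) × (i ≤ p) × (1 ≤ j) × (j ≤ q)

center : ℕ → ℕ
center p = suc (p / 2)

-- Partial bicentrally balanced C₄-face-magic labeling on the p × q subgrid of 𝒫_{M,N}.
-- Half-integer equations (4),(5) are stated after multiplying both sides by 2.
record PBB (M N p q : ℕ) (x : Label) : Set where
  field
    p-odd : IsOdd p
    q-odd : IsOdd q
    p≥3   : 3 ≤ p
    q≥3   : 3 ≤ q
    p≤M   : p ≤ M
    q≤N   : q ≤ N
    face  : ∀ i j → 1 ≤ i → suc i ≤ p → 1 ≤ j → suc j ≤ q →
            x i j + x (suc i) j + x i (suc j) + x (suc i) (suc j)
              ≡ + (2 ℕ.* M ℕ.* N ℕ.+ 3)
    even-in  : ∀ i j → InGrid p q i j → IsEven (i ℕ.+ j) →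
               (+ 1 ℤ.≤ x i j) × (x i j ℤ.≤ + ((p ℕ.* q ℕ.+ 1) / 2))
    even-all : ∀ (v : ℤ) → + 1 ℤ.≤ v → v ℤ.≤ + ((p ℕ.* q ℕ.+ 1) / 2) →
               ∃[ i ] ∃[ j ] (InGrid p q i j × IsEven (i ℕ.+ j) × x i j ≡ v)
    odd-in   : ∀ i j → InGrid p q i j → IsOdd (i ℕ.+ j) →
               (+ (M ℕ.* N) - + ((p ℕ.* q ℕ.∸ 3) / 2) ℤ.≤ x i j) × (x i j ℤ.≤ + (M ℕ.* N))
    odd-all  : ∀ (v : ℤ) → + (M ℕ.* N) - + ((p ℕ.* q ℕ.∸ 3) / 2) ℤ.≤ v → v ℤ.≤ + (M ℕ.* N) →
               ∃[ i ] ∃[ j ] (InGrid p q i j × IsOdd (i ℕ.+ j) × x i j ≡ v)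
    bal-even : ∀ i j → InGrid p q i j → IsEven (i ℕ.+ j) →
               + 2 * (x i j + x (suc p ℕ.∸ i) (suc q ℕ.∸ j)) ≡ + (p ℕ.* q ℕ.+ 3)
    bal-odd  : ∀ i j → InGrid p q i j → IsOdd (i ℕ.+ j) →
               + 2 * (x i j + x (suc p ℕ.∸ i) (suc q ℕ.∸ j))
                 ≡ + (4 ℕ.* M ℕ.* N) - + (p ℕ.* q) + + 3
    col-even : ∀ i → 1 ≤ i → i ℕ.+ 2 ≤ p → IsEven (i ℕ.+ center q) →
               x i (center q) ℤ.< x (i ℕ.+ 2) (center q)
    col-odd  : ∀ i → 1 ≤ i → i ℕ.+ 2 ≤ p → IsOdd (i ℕ.+ center q) →
               x (i ℕ.+ 2) (center q) ℤ.< x i (center q)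
    row-even : ∀ j → 1 ≤ j → j ℕ.+ 2 ≤ q → IsEven (center p ℕ.+ j) →
               x (center p) j ℤ.< x (center p) (j ℕ.+ 2)
    row-odd  : ∀ j → 1 ≤ j → j ℕ.+ 2 ≤ q → IsOdd (center p ℕ.+ j) →
               x (center p) (j ℕ.+ 2) ℤ.< x (center p) j

-- The value formulas of HASC^r / VASC^r, shared; (k - 1/2)mn half-integers are
-- handled by doubling both sides.  For odd r = 2 r₀ + 1, r₀ = r / 2.
-- `pos k i j` gives the position of the copy of (i , j) in block number k.
ASCRel : (M N m n r : ℕ) (pos : ℕ → ℕ → ℕ → ℕ × ℕ) (x y : Label) → Set
ASCRel M N m n r pos x y = ∀ i j → InGrid m n i j →
  (∀ k → 1 ≤ k → k ≤ r / 2 →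
     let (a , b) = pos (2 ℕ.* k ℕ.∸ 1) i j
         c = + ((2 ℕ.* k ℕ.∸ 1) ℕ.* m ℕ.* n) in
     (IsOdd (i ℕ.+ j) →
        + 2 * y a b ≡ + (2 ℕ.* M ℕ.* N) - + 2 * x i j + c + + 3)
   × (IsEven (i ℕ.+ j) →
        + 2 * y a b ≡ + (2 ℕ.* M ℕ.* N) - + 2 * x i j - c + + 3))
  × (∀ k → k ≤ r / 2 →
     let (a , b) = pos (2 ℕ.* k) i j
         d = + (k ℕ.* m ℕ.* n) in
     (IsOdd (i ℕ.+ j) → y a b ≡ x i j - d)
   × (IsEven (i ℕ.+ j) → y a b ≡ x i j + d))
  where open import Data.Product using (_,_)

IsHASC : (M N m n r : ℕ) (x y : Label) → Set
IsHASC M N m n r = ASCRel M N m n r (λ t i j → (t ℕ.* m ℕ.+ i , j))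
  where open import Data.Product using (_,_)

IsVASC : (M N m n r : ℕ) (x y : Label) → Set
IsVASC M N m n r = ASCRel M N m n r (λ t i j → (i , t ℕ.* n ℕ.+ j))
  where open import Data.Product using (_,_)

{-# OPTIONS --safe #-}
-- Write r = 2c + 1 and mn = 2v + 3, and rank the small labels 1, 2, … upwards and the large
-- labels MN, MN − 1, … downwards.  Block 2k of HASC^r(X) is a copy of X and block 2k + 1 a copy
-- reflected by x ↦ MN − x, which swaps small and large labels; in both, every rank is shifted by
-- the number of labels of the same kind in the earlier blocks.  So the blocks fill consecutive
-- rank intervals: this gives the label sets (2), (3) and the monotonicity (6) across block
-- boundaries, while inside a block (6) is inherited from X because the block map is monotone or
-- antitone.  Shifts and reflections preserve face sums; a face straddling two blocks sums a row
-- pair of X at rows m and 1, and these agree because adjacent faces force row pair sums to repeat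
-- every two rows and m is odd.  The half-turn maps block t onto block r − 1 − t of the same
-- parity, which gives (4), (5).  VASC^r is HASC^r of the transpose.
module Submission where

open import Data.Nat as ℕ using (ℕ; zero; suc; _∸_; _/_; z≤n; s≤s; parity; NonZero)
import Data.Nat.Properties as ℕₚ
open import Data.Nat.DivMod using (m≡m%n+[m/n]*n; m%n<n; m<n*o⇒m/o<n; m*n/n≡m; m*n%n≡0; +-distrib-/)
import Data.Nat.Tactic.RingSolver as ℕ-Ring
open import Data.Integer using (ℤ; +_; +≤+; +<+; ∣_∣)
import Data.Integer.Properties as ℤₚ
open import Data.Integer.Tactic.RingSolver using (solve-∀)
open import Data.Parity.Base as ℙ using (Parity; 0ℙ; 1ℙ; _⁻¹)
import Data.Parity.Properties as ℙₚ
open import Data.Product using (_×_; _,_; proj₁; proj₂; ∃; ∃₂; map₂)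
open import Data.Sum using (inj₁; inj₂)
open import Data.Empty using (⊥-elim)
open import Function using (_∘_)
open import Relation.Binary.PropositionalEquality
open import Relation.Nullary using (yes; no)
open import Defs

odd⇒parity≡1ℙ : ∀ n → IsOdd n → parity n ≡ 1ℙ
odd⇒parity≡1ℙ 0 ()
odd⇒parity≡1ℙ 1 _ = refl
odd⇒parity≡1ℙ (suc (suc n)) = odd⇒parity≡1ℙ n

even⇒parity≡0ℙ : ∀ n → IsEven n → parity n ≡ 0ℙ
even⇒parity≡0ℙ 0 _ = refl
even⇒parity≡0ℙ 1 ()
even⇒parity≡0ℙ (suc (suc n)) = even⇒parity≡0ℙ n

parity≡1ℙ⇒odd : ∀ n → parity n ≡ 1ℙ → IsOdd n
parity≡1ℙ⇒odd 0 ()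
parity≡1ℙ⇒odd 1 _ = refl
parity≡1ℙ⇒odd (suc (suc n)) = parity≡1ℙ⇒odd n

parity≡0ℙ⇒even : ∀ n → parity n ≡ 0ℙ → IsEven n
parity≡0ℙ⇒even 0 _ = refl
parity≡0ℙ⇒even 1 ()
parity≡0ℙ⇒even (suc (suc n)) = parity≡0ℙ⇒even n

parity-suc : ∀ n → parity (suc n) ≡ parity n ⁻¹
parity-suc = ℙₚ.+-homo-+ 1

parity-comm : ∀ i j → parity (i ℕ.+ j) ≡ parity (j ℕ.+ i)
parity-comm i j = cong parity (ℕₚ.+-comm i j)

parity-+2ˡ : ∀ i j → parity (i ℕ.+ 2 ℕ.+ j) ≡ parity (i ℕ.+ j)
parity-+2ˡ i j = cong parity (trans (ℕₚ.+-assoc i 2 j) (trans (ℕₚ.+-suc i (suc j)) (cong suc (ℕₚ.+-suc i j))))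

parity-+2ʳ : ∀ i j → parity (i ℕ.+ (j ℕ.+ 2)) ≡ parity (i ℕ.+ j)
parity-+2ʳ i j = cong parity (trans (sym (ℕₚ.+-assoc i j 2)) (ℕₚ.+-comm (i ℕ.+ j) 2))

p+[p+q]≡q : ∀ p q → p ℙ.+ (p ℙ.+ q) ≡ q
p+[p+q]≡q 0ℙ q = refl
p+[p+q]≡q 1ℙ q = ℙₚ.⁻¹-involutive q

parity[odd*odd]≡1ℙ : ∀ p q → IsOdd p → IsOdd q → parity (p ℕ.* q) ≡ 1ℙ
parity[odd*odd]≡1ℙ p q p-odd q-odd =
  trans (ℙₚ.*-homo-* p q) (cong₂ ℙ._*_ (odd⇒parity≡1ℙ p p-odd) (odd⇒parity≡1ℙ q q-odd))

blockIndex : Parity → ℕ → ℕ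
blockIndex 0ℙ k = k ℕ.* 2
blockIndex 1ℙ k = suc (k ℕ.* 2)

parity-blockIndex : ∀ e k → parity (blockIndex e k) ≡ e
parity-blockIndex 0ℙ zero    = refl
parity-blockIndex 0ℙ (suc k) = parity-blockIndex 0ℙ k
parity-blockIndex 1ℙ zero    = refl
parity-blockIndex 1ℙ (suc k) = parity-blockIndex 1ℙ k

blockIndex-surjective : ∀ t → ∃₂ λ e k → t ≡ blockIndex e k
blockIndex-surjective 0 = 0ℙ , 0 , refl
blockIndex-surjective 1 = 1ℙ , 0 , refl
blockIndex-surjective (suc (suc t)) with blockIndex-surjective t
... | 0ℙ , k , refl = 0ℙ , suc k , refl
... | 1ℙ , k , refl = 1ℙ , suc k , refl

parity≡1ℙ⇒suc[h*2] : ∀ n → parity n ≡ 1ℙ → ∃ λ h → n ≡ suc (h ℕ.* 2)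
parity≡1ℙ⇒suc[h*2] n odd with blockIndex-surjective n
... | 1ℙ , h , n≡ = h , n≡
... | 0ℙ , h , refl with () ← trans (sym (parity-blockIndex 0ℙ h)) odd

odd-area : ∀ {p q} → IsOdd p → IsOdd q → 3 ℕ.≤ p → 3 ℕ.≤ q → ∃ λ w → p ℕ.* q ≡ 3 ℕ.+ w ℕ.* 2
odd-area {p} {q} p-odd q-odd p≥3 q≥3 with parity≡1ℙ⇒suc[h*2] (p ℕ.* q) (parity[odd*odd]≡1ℙ p q p-odd q-odd)
... | suc w , pq≡ = w , pq≡
... | zero  , pq≡ with s≤s () ← subst (3 ℕ.≤_) pq≡ (ℕₚ.*-mono-≤ p≥3 (ℕₚ.≤-trans (s≤s z≤n) q≥3))

blockIndex-sum-0ℙ : ∀ k k′ c → blockIndex 0ℙ k ℕ.+ blockIndex 0ℙ k′ ≡ c ℕ.* 2 → c ≡ k ℕ.+ k′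
blockIndex-sum-0ℙ k k′ c sum = ℕₚ.*-cancelʳ-≡ c (k ℕ.+ k′) 2 (trans (sym sum) (sym (ℕₚ.*-distribʳ-+ 2 k k′)))

blockIndex-sum-1ℙ : ∀ k k′ c → blockIndex 1ℙ k ℕ.+ blockIndex 1ℙ k′ ≡ c ℕ.* 2 → c ≡ suc (k ℕ.+ k′)
blockIndex-sum-1ℙ k k′ c sum = ℕₚ.*-cancelʳ-≡ c (suc (k ℕ.+ k′)) 2 (trans (sym sum) pair)
  where
  pair : suc (k ℕ.* 2) ℕ.+ suc (k′ ℕ.* 2) ≡ suc (k ℕ.+ k′) ℕ.* 2
  pair = trans (cong suc (ℕₚ.+-suc (k ℕ.* 2) (k′ ℕ.* 2))) (cong (suc ∘ suc) (sym (ℕₚ.*-distribʳ-+ 2 k k′)))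

mirror-block : ∀ e k c → blockIndex e k ℕ.≤ c ℕ.* 2 →
  ∃ λ k′ → blockIndex e k ℕ.+ blockIndex e k′ ≡ c ℕ.* 2
mirror-block 0ℙ zero    c       _ = c , refl
mirror-block 1ℙ zero    (suc c) _ = c , refl
mirror-block 0ℙ (suc k) (suc c) (s≤s (s≤s t≤)) = map₂ (cong (2 ℕ.+_)) (mirror-block 0ℙ k c t≤)
mirror-block 1ℙ (suc k) (suc c) (s≤s (s≤s t≤)) = map₂ (cong (2 ℕ.+_)) (mirror-block 1ℙ k c t≤)

suc[n*2]/2≡n : ∀ n → suc (n ℕ.* 2) / 2 ≡ n
suc[n*2]/2≡n n = trans (+-distrib-/ 1 (n ℕ.* 2) 1+[n*2]%2<2) (m*n/n≡m n 2)
  where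
  1+[n*2]%2<2 : 1 ℕ.+ (n ℕ.* 2) ℕ.% 2 ℕ.< 2
  1+[n*2]%2<2 = subst (λ r → 1 ℕ.+ r ℕ.< 2) (sym (m*n%n≡0 n 2)) ℕₚ.≤-refl

center-odd : ∀ h → center (suc (h ℕ.* 2)) ≡ suc h
center-odd h = cong suc (suc[n*2]/2≡n h)

center-bounds : ∀ p → parity p ≡ 1ℙ → 1 ℕ.≤ center p × center p ℕ.≤ p
center-bounds p odd with parity≡1ℙ⇒suc[h*2] p odd
... | h , refl = s≤s z≤n , subst (ℕ._≤ suc (h ℕ.* 2)) (sym (center-odd h)) (s≤s (ℕₚ.m≤m*n h 2))

row-decomposition : ∀ m r I .{{_ : NonZero m}} → 1 ℕ.≤ I → I ℕ.≤ m ℕ.* r →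
  ∃₂ λ t i → I ≡ t ℕ.* m ℕ.+ i × 1 ℕ.≤ i × i ℕ.≤ m × t ℕ.< r
row-decomposition m r (suc I) _ I<mr = I / m , suc (I ℕ.% m) , I≡ , s≤s z≤n , m%n<n I m , I/m<r
  where
  I≡ : suc I ≡ I / m ℕ.* m ℕ.+ suc (I ℕ.% m)
  I≡ = trans (cong suc (trans (m≡m%n+[m/n]*n I m) (ℕₚ.+-comm (I ℕ.% m) _))) (sym (ℕₚ.+-suc _ _))
  I/m<r : I / m ℕ.< r
  I/m<r = m<n*o⇒m/o<n (subst (I ℕ.<_) (ℕₚ.*-comm m r) I<mr)

mirror-row : ∀ m c t t′ i → t ℕ.+ t′ ≡ c ℕ.* 2 → i ℕ.≤ suc m →
  suc (m ℕ.* suc (c ℕ.* 2)) ∸ (t ℕ.* m ℕ.+ i) ≡ t′ ℕ.* m ℕ.+ (suc m ∸ i)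
mirror-row m c t t′ i t+t′≡ i≤ = begin
    suc (m ℕ.* suc (c ℕ.* 2)) ∸ I
  ≡⟨ cong (λ s → suc (m ℕ.* suc s) ∸ I) (sym t+t′≡) ⟩
    suc (m ℕ.* suc (t ℕ.+ t′)) ∸ I
  ≡⟨ cong (_∸ I) (spread m t t′) ⟩
    t ℕ.* m ℕ.+ t′ ℕ.* m ℕ.+ suc m ∸ I
  ≡⟨ cong (λ s → t ℕ.* m ℕ.+ t′ ℕ.* m ℕ.+ s ∸ I) (sym (ℕₚ.m+[n∸m]≡n i≤)) ⟩
    t ℕ.* m ℕ.+ t′ ℕ.* m ℕ.+ (i ℕ.+ (suc m ∸ i)) ∸ I
  ≡⟨ cong (_∸ I) (regroup (t ℕ.* m) (t′ ℕ.* m) i (suc m ∸ i)) ⟩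
    I ℕ.+ (t′ ℕ.* m ℕ.+ (suc m ∸ i)) ∸ I
  ≡⟨ ℕₚ.m+n∸m≡n I _ ⟩
    t′ ℕ.* m ℕ.+ (suc m ∸ i)
  ∎
  where
  open ≡-Reasoning
  I : ℕ
  I = t ℕ.* m ℕ.+ i
  spread : ∀ m t t′ → suc (m ℕ.* suc (t ℕ.+ t′)) ≡ t ℕ.* m ℕ.+ t′ ℕ.* m ℕ.+ suc m
  spread = ℕ-Ring.solve-∀
  regroup : ∀ a b c d → a ℕ.+ b ℕ.+ (c ℕ.+ d) ≡ a ℕ.+ c ℕ.+ (b ℕ.+ d)
  regroup = ℕ-Ring.solve-∀

mirror-parity : ∀ {p q} i j → parity p ≡ parity q → i ℕ.≤ suc p → j ℕ.≤ suc q →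
  parity ((suc p ∸ i) ℕ.+ (suc q ∸ j)) ≡ parity (i ℕ.+ j)
mirror-parity {p} {q} i j p≡q i≤ j≤ = begin
    parity (i′ ℕ.+ j′)
  ≡⟨ sym (p+[p+q]≡q (parity (i ℕ.+ j)) _) ⟩
    parity (i ℕ.+ j) ℙ.+ (parity (i ℕ.+ j) ℙ.+ parity (i′ ℕ.+ j′))
  ≡⟨ cong (parity (i ℕ.+ j) ℙ.+_) (sym (ℙₚ.+-homo-+ (i ℕ.+ j) (i′ ℕ.+ j′))) ⟩
    parity (i ℕ.+ j) ℙ.+ parity (i ℕ.+ j ℕ.+ (i′ ℕ.+ j′))
  ≡⟨ cong (λ s → parity (i ℕ.+ j) ℙ.+ parity s) total ⟩
    parity (i ℕ.+ j) ℙ.+ parity (suc p ℕ.+ suc q)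
  ≡⟨ cong (parity (i ℕ.+ j) ℙ.+_) even-total ⟩
    parity (i ℕ.+ j) ℙ.+ 0ℙ
  ≡⟨ ℙₚ.+-identityʳ _ ⟩
    parity (i ℕ.+ j)
  ∎
  where
  open ≡-Reasoning
  i′ : ℕ
  i′ = suc p ∸ i
  j′ : ℕ
  j′ = suc q ∸ j
  regroup : ∀ a b c d → a ℕ.+ b ℕ.+ (c ℕ.+ d) ≡ a ℕ.+ c ℕ.+ (b ℕ.+ d)
  regroup = ℕ-Ring.solve-∀
  total : i ℕ.+ j ℕ.+ (i′ ℕ.+ j′) ≡ suc p ℕ.+ suc q
  total = trans (regroup i j i′ j′) (cong₂ ℕ._+_ (ℕₚ.m+[n∸m]≡n i≤) (ℕₚ.m+[n∸m]≡n j≤))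
  suc-p≡suc-q : parity (suc p) ≡ parity (suc q)
  suc-p≡suc-q = trans (parity-suc p) (trans (cong _⁻¹ p≡q) (sym (parity-suc q)))
  even-total : parity (suc p ℕ.+ suc q) ≡ 0ℙ
  even-total = begin
      parity (suc p ℕ.+ suc q)          ≡⟨ ℙₚ.+-homo-+ (suc p) (suc q) ⟩
      parity (suc p) ℙ.+ parity (suc q) ≡⟨ cong (ℙ._+ parity (suc q)) suc-p≡suc-q ⟩
      parity (suc q) ℙ.+ parity (suc q) ≡⟨ ℙₚ.p+p≡0ℙ (parity (suc q)) ⟩
      0ℙ                                ∎

mirror-InGrid : ∀ {p q i j} → InGrid p q i j → InGrid p q (suc p ∸ i) (suc q ∸ j)
mirror-InGrid (1≤i , i≤p , 1≤j , j≤q) =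
  ℕₚ.m<n⇒0<n∸m (s≤s i≤p) , ℕₚ.∸-monoʳ-≤ _ 1≤i , ℕₚ.m<n⇒0<n∸m (s≤s j≤q) , ℕₚ.∸-monoʳ-≤ _ 1≤j

transpose : Label → Label
transpose x i j = x j i

InGrid-transpose : ∀ {p q i j} → InGrid p q i j → InGrid q p j i
InGrid-transpose (1≤i , i≤p , 1≤j , j≤q) = 1≤j , j≤q , 1≤i , i≤p

module _ (f : ℕ → ℕ) (f-step : ∀ t → f t ℕ.≤ f (suc t)) where

  stepwise-mono : ∀ {s t} → s ℕ.≤ t → f s ℕ.≤ f t
  stepwise-mono = mono ∘ ℕₚ.≤⇒≤′
    where
    mono : ∀ {s t} → s ℕ.≤′ t → f s ℕ.≤ f t
    mono ℕ.≤′-refl        = ℕₚ.≤-refl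
    mono (ℕ.≤′-step s≤′t) = ℕₚ.≤-trans (mono s≤′t) (f-step _)

  stepwise-locate : ∀ r u → f 0 ℕ.< u → u ℕ.≤ f r →
    ∃ λ t → t ℕ.< r × f t ℕ.< u × u ℕ.≤ f (suc t)
  stepwise-locate zero    u f0<u u≤f0 = ⊥-elim (ℕₚ.<⇒≱ f0<u u≤f0)
  stepwise-locate (suc r) u f0<u u≤f[1+r] with u ℕ.≤? f r
  ... | yes u≤fr = map₂ (λ (t<r , rest) → ℕₚ.m≤n⇒m≤1+n t<r , rest) (stepwise-locate r u f0<u u≤fr)
  ... | no  u≰fr = r , ℕₚ.≤-refl , ℕₚ.≰⇒> u≰fr , u≤f[1+r]

module Labelling where
  open import Data.Integer using (_+_; _-_; -_; _*_; _≤_; _<_)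

  rankedLabel : ℕ → Parity → ℕ → ℤ
  rankedLabel K 0ℙ u = + u
  rankedLabel K 1ℙ u = + 1 + + K - + u

  labelCount : ℕ → Parity → ℕ
  labelCount w 0ℙ = w ℕ.+ 2
  labelCount w 1ℙ = w ℕ.+ 1

  RankIn : ℕ → Parity → ℕ → ℕ → ℤ → Set
  RankIn K b lo hi y = ∃ λ u → lo ℕ.< u × u ℕ.≤ hi × y ≡ rankedLabel K b u

  balanceSum : ℕ → ℕ → Parity → ℤ
  balanceSum K w 0ℙ = + w + + 3
  balanceSum K w 1ℙ = + 2 * + K - + w

  Ordered : Parity → ℤ → ℤ → Set
  Ordered 0ℙ x y = x < y
  Ordered 1ℙ x y = y < x

  Ordered-translate : ∀ q c {x y} → Ordered q x y → Ordered q (x + c) (y + c)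
  Ordered-translate 0ℙ c = ℤₚ.+-monoˡ-< c
  Ordered-translate 1ℙ c = ℤₚ.+-monoˡ-< c

  Ordered-reflect : ∀ q a {x y} → Ordered q x y → Ordered (q ⁻¹) (a - x) (a - y)
  Ordered-reflect 0ℙ a = ℤₚ.+-monoʳ-< a ∘ ℤₚ.neg-mono-<
  Ordered-reflect 1ℙ a = ℤₚ.+-monoʳ-< a ∘ ℤₚ.neg-mono-<

  rankedLabel-ordered : ∀ K b {u u′} → u ℕ.< u′ → Ordered b (rankedLabel K b u) (rankedLabel K b u′)
  rankedLabel-ordered K 0ℙ = +<+
  rankedLabel-ordered K 1ℙ = Ordered-reflect 0ℙ (+ 1 + + K) ∘ +<+

  FaceMagic : ℕ → ℕ → ℤ → Label → Set
  FaceMagic p q S x = ∀ i j → 1 ℕ.≤ i → suc i ℕ.≤ p → 1 ℕ.≤ j → suc j ℕ.≤ q →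
    x i j + x (suc i) j + x i (suc j) + x (suc i) (suc j) ≡ S

  -- PBB with K = MN and pq = 2w + 3: (2), (3) say that the cells of parity b carry exactly the
  -- labels of rank 1 … labelCount w b, and (4), (5) are stated without the factor 2.
  record Bicentral (K p q w : ℕ) (x : Label) : Set where
    field
      area    : p ℕ.* q ≡ 3 ℕ.+ w ℕ.* 2
      face    : FaceMagic p q (+ 2 * + K + + 3) x
      ranked  : ∀ i j → InGrid p q i j →
                RankIn K (parity (i ℕ.+ j)) 0 (labelCount w (parity (i ℕ.+ j))) (x i j)
      onto    : ∀ b y → RankIn K b 0 (labelCount w b) y →
                ∃₂ λ i j → InGrid p q i j × parity (i ℕ.+ j) ≡ b × x i j ≡ y
      balance : ∀ i j → InGrid p q i j →
                x i j + x (suc p ∸ i) (suc q ∸ j) ≡ balanceSum K w (parity (i ℕ.+ j))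
      column  : ∀ i → 1 ℕ.≤ i → i ℕ.+ 2 ℕ.≤ p →
                Ordered (parity (i ℕ.+ center q)) (x i (center q)) (x (i ℕ.+ 2) (center q))
      row     : ∀ j → 1 ℕ.≤ j → j ℕ.+ 2 ℕ.≤ q →
                Ordered (parity (center p ℕ.+ j)) (x (center p) j) (x (center p) (j ℕ.+ 2))

  solveFor : ∀ {x x′ s} → x + x′ ≡ s → x′ ≡ s - x
  solveFor {x} {x′} refl = sym (cancel x x′)
    where
    cancel : ∀ x y → x + y - x ≡ y
    cancel = solve-∀

  adjacent-faces : ∀ A A′ B B′ C C′ {S} → A + B + A′ + B′ ≡ S → B + C + B′ + C′ ≡ S → C + C′ ≡ A + A′
  adjacent-faces A A′ B B′ C C′ refl eq = trans (solveFor (trans (regroup B C B′ C′) eq)) (cancel A A′ B B′)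
    where
    regroup : ∀ B C B′ C′ → B + B′ + (C + C′) ≡ B + C + B′ + C′
    regroup = solve-∀
    cancel : ∀ A A′ B B′ → A + B + A′ + B′ - (B + B′) ≡ A + A′
    cancel = solve-∀

  rowPair-periodic : ∀ {p q S x} → FaceMagic p q S x → ∀ a j → suc (a ℕ.* 2) ℕ.≤ p →
    1 ℕ.≤ j → suc j ℕ.≤ q → x (suc (a ℕ.* 2)) j + x (suc (a ℕ.* 2)) (suc j) ≡ x 1 j + x 1 (suc j)
  rowPair-periodic face zero    j _ _ _ = refl
  rowPair-periodic {x = x} face (suc a) j i+2≤p 1≤j j<q =
    trans (adjacent-faces (x i j) (x i (suc j)) (x (suc i) j) (x (suc i) (suc j))
                          (x (suc (suc i)) j) (x (suc (suc i)) (suc j))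
                          (face i j (s≤s z≤n) (ℕₚ.≤-trans (ℕₚ.n≤1+n _) i+2≤p) 1≤j j<q)
                          (face (suc i) j (s≤s z≤n) i+2≤p 1≤j j<q))
          (rowPair-periodic {x = x} face a j (ℕₚ.≤-trans (ℕₚ.n≤1+n _) (ℕₚ.≤-trans (ℕₚ.n≤1+n _) i+2≤p)) 1≤j j<q)
    where
    i : ℕ
    i = suc (a ℕ.* 2)

  RankIn-ordered : ∀ {K b lo mid hi y y′} → RankIn K b lo mid y → RankIn K b mid hi y′ → Ordered b y y′
  RankIn-ordered {K} {b} (u , _ , u≤mid , refl) (u′ , mid<u′ , _ , refl) =
    rankedLabel-ordered K b (ℕₚ.≤-<-trans u≤mid mid<u′)

  sum₄-cong : ∀ {a a′ b b′ c c′ d d′ : ℤ} → a ≡ a′ → b ≡ b′ → c ≡ c′ → d ≡ d′ →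
    a + b + c + d ≡ a′ + b′ + c′ + d′
  sum₄-cong refl refl refl refl = refl

  Bicentral-transpose : ∀ {K p q w x} → Bicentral K p q w x → Bicentral K q p w (transpose x)
  Bicentral-transpose {K} {p} {q} {w} {x} B = record
    { area    = trans (ℕₚ.*-comm q p) area
    ; face    = λ i j 1≤i i<q 1≤j j<p →
                  trans (swap (x j i) (x j (suc i)) (x (suc j) i) (x (suc j) (suc i))) (face j i 1≤j j<p 1≤i i<q)
    ; ranked  = λ i j g → subst (λ b → RankIn K b 0 (labelCount w b) (x j i)) (parity-comm j i)
                                (ranked j i (InGrid-transpose g))
    ; onto    = onto′
    ; balance = λ i j g → trans (balance j i (InGrid-transpose g)) (cong (balanceSum K w) (parity-comm j i))
    ; column  = λ i 1≤i i+2≤q → subst (λ b → Ordered b (x (center p) i) (x (center p) (i ℕ.+ 2)))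
                                      (parity-comm (center p) i) (row i 1≤i i+2≤q)
    ; row     = λ j 1≤j j+2≤p → subst (λ b → Ordered b (x j (center q)) (x (j ℕ.+ 2) (center q)))
                                      (parity-comm j (center q)) (column j 1≤j j+2≤p)
    }
    where
    open Bicentral B
    swap : ∀ a b c d → a + b + c + d ≡ a + c + b + d
    swap = solve-∀
    onto′ : ∀ b y → RankIn K b 0 (labelCount w b) y →
            ∃₂ λ i j → InGrid q p i j × parity (i ℕ.+ j) ≡ b × transpose x i j ≡ y
    onto′ b y h with onto b y h
    ... | i , j , g , par , x≡ = j , i , InGrid-transpose g , trans (parity-comm j i) par , x≡

open Labelling

module Conversions where
  open import Data.Integer using (_+_; _-_; -_; _*_; _≤_; _<_)

  halves : ∀ {n} w → n ≡ 3 ℕ.+ w ℕ.* 2 → (n ℕ.+ 1) / 2 ≡ w ℕ.+ 2 × (n ∸ 3) / 2 ≡ w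
  halves w refl = trans (cong (_/ 2) (double w)) (m*n/n≡m (w ℕ.+ 2) 2) , m*n/n≡m w 2
    where
    double : ∀ w → 3 ℕ.+ w ℕ.* 2 ℕ.+ 1 ≡ (w ℕ.+ 2) ℕ.* 2
    double = ℕ-Ring.solve-∀

  small-rank : ∀ {K w y} → + 1 ≤ y → y ≤ + (w ℕ.+ 2) → RankIn K 0ℙ 0 (labelCount w 0ℙ) y
  small-rank (+≤+ 1≤u) (+≤+ u≤) = _ , 1≤u , u≤ , refl

  small-bounds : ∀ {K w y} → RankIn K 0ℙ 0 (labelCount w 0ℙ) y → + 1 ≤ y × y ≤ + (w ℕ.+ 2)
  small-bounds (u , 0<u , u≤ , refl) = +≤+ 0<u , +≤+ u≤

  large-rank : ∀ {K w y} → + K - + w ≤ y → y ≤ + K → RankIn K 1ℙ 0 (labelCount w 1ℙ) y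
  large-rank {K} {w} {y} K-w≤y y≤K =
    suc δ , s≤s z≤n , subst (suc δ ℕ.≤_) (ℕₚ.+-comm 1 w) (s≤s (ℤₚ.drop‿+≤+ δ≤w)) ,
    trans (ring y (+ K)) (cong (λ d → + 1 + + K - (+ 1 + d)) (sym +δ≡))
    where
    δ : ℕ
    δ = ∣ + K - y ∣
    +δ≡ : + δ ≡ + K - y
    +δ≡ = ℤₚ.0≤i⇒+∣i∣≡i (ℤₚ.i≤j⇒0≤j-i y≤K)
    δ≤w : + δ ≤ + w
    δ≤w = subst₂ _≤_ (sym +δ≡) (cancel (+ K) (+ w)) (ℤₚ.+-monoʳ-≤ (+ K) (ℤₚ.neg-mono-≤ K-w≤y))
      where
      cancel : ∀ K w → K - (K - w) ≡ w
      cancel = solve-∀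
    ring : ∀ y K → y ≡ + 1 + K - (+ 1 + (K - y))
    ring = solve-∀

  large-bounds : ∀ {K w y} → RankIn K 1ℙ 0 (labelCount w 1ℙ) y → + K - + w ≤ y × y ≤ + K
  large-bounds {K} {w} (suc δ , _ , δ<w+1 , refl) =
    subst (+ K - + w ≤_) (sym y≡) (ℤₚ.+-monoʳ-≤ (+ K) (ℤₚ.neg-mono-≤ (+≤+ δ≤w))) ,
    subst (_≤ + K) (sym y≡) (ℤₚ.i≤j⇒i-k≤j (+ δ) ℤₚ.≤-refl)
    where
    δ≤w : δ ℕ.≤ w
    δ≤w = ℕₚ.≤-pred (subst (suc δ ℕ.≤_) (ℕₚ.+-comm w 1) δ<w+1)
    ring : ∀ K d → + 1 + K - (+ 1 + d) ≡ K - d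
    ring = solve-∀
    y≡ : + 1 + + K - + suc δ ≡ + K - + δ
    y≡ = ring (+ K) (+ δ)

  +[2*M*N]≡2*K : ∀ M N → + (2 ℕ.* M ℕ.* N) ≡ + 2 * + (M ℕ.* N)
  +[2*M*N]≡2*K M N = trans (cong +_ (ℕₚ.*-assoc 2 M N)) (ℤₚ.pos-* 2 (M ℕ.* N))

  +[2*M*N+3]≡2*K+3 : ∀ M N → + (2 ℕ.* M ℕ.* N ℕ.+ 3) ≡ + 2 * + (M ℕ.* N) + + 3
  +[2*M*N+3]≡2*K+3 M N = cong (_+ + 3) (+[2*M*N]≡2*K M N)

  even-balance≡ : ∀ {n} w → n ≡ 3 ℕ.+ w ℕ.* 2 → + (n ℕ.+ 3) ≡ + 2 * (+ w + + 3)
  even-balance≡ w refl = trans (cong +_ (double w)) (ℤₚ.pos-* 2 (w ℕ.+ 3))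
    where
    double : ∀ w → 3 ℕ.+ w ℕ.* 2 ℕ.+ 3 ≡ 2 ℕ.* (w ℕ.+ 3)
    double = ℕ-Ring.solve-∀

  odd-balance≡ : ∀ {n} M N w → n ≡ 3 ℕ.+ w ℕ.* 2 →
    + (4 ℕ.* M ℕ.* N) - + n + + 3 ≡ + 2 * (+ 2 * + (M ℕ.* N) - + w)
  odd-balance≡ M N w refl =
    trans (cong₂ (λ a b → a - (+ 3 + b) + + 3) (trans (cong +_ (ℕₚ.*-assoc 4 M N)) (ℤₚ.pos-* 4 (M ℕ.* N))) (ℤₚ.pos-* w 2))
          (ring (+ (M ℕ.* N)) (+ w))
    where
    ring : ∀ K w → + 4 * K - (+ 3 + w * + 2) + + 3 ≡ + 2 * (+ 2 * K - w)
    ring = solve-∀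

  PBB⇒Bicentral : ∀ {M N p q x} → PBB M N p q x → ∃ λ w → Bicentral (M ℕ.* N) p q w x
  PBB⇒Bicentral {M} {N} {p} {q} {x} P with odd-area {p} {q} (PBB.p-odd P) (PBB.q-odd P) (PBB.p≥3 P) (PBB.q≥3 P)
  ... | w , pq≡ = w , record
    { area    = pq≡
    ; face    = λ i j 1≤i i<p 1≤j j<q → trans (face i j 1≤i i<p 1≤j j<q) (+[2*M*N+3]≡2*K+3 M N)
    ; ranked  = ranked
    ; onto    = onto
    ; balance = balance
    ; column  = column
    ; row     = row
    }
    where
    open PBB P
    K : ℕ
    K = M ℕ.* N
    half+1 : (p ℕ.* q ℕ.+ 1) / 2 ≡ w ℕ.+ 2
    half+1 = proj₁ (halves w pq≡)
    half-3 : (p ℕ.* q ∸ 3) / 2 ≡ w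
    half-3 = proj₂ (halves w pq≡)
    ranked : ∀ i j → InGrid p q i j → RankIn K (parity (i ℕ.+ j)) 0 (labelCount w (parity (i ℕ.+ j))) (x i j)
    ranked i j g with parity (i ℕ.+ j) in par
    ... | 0ℙ = let lo , hi = even-in i j g (parity≡0ℙ⇒even (i ℕ.+ j) par)
               in small-rank {K} lo (subst (λ h → x i j ≤ + h) half+1 hi)
    ... | 1ℙ = let lo , hi = odd-in i j g (parity≡1ℙ⇒odd (i ℕ.+ j) par)
               in large-rank (subst (λ h → + K - + h ≤ x i j) half-3 lo) hi
    onto : ∀ b y → RankIn K b 0 (labelCount w b) y → ∃₂ λ i j → InGrid p q i j × parity (i ℕ.+ j) ≡ b × x i j ≡ y
    onto 0ℙ y h with small-bounds {K} h
    ... | lo , hi with even-all y lo (subst (λ h → y ≤ + h) (sym half+1) hi)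
    ... | i , j , g , even , x≡ = i , j , g , even⇒parity≡0ℙ (i ℕ.+ j) even , x≡
    onto 1ℙ y h with large-bounds h
    ... | lo , hi with odd-all y (subst (λ h → + K - + h ≤ y) (sym half-3) lo) hi
    ... | i , j , g , odd , x≡ = i , j , g , odd⇒parity≡1ℙ (i ℕ.+ j) odd , x≡
    balance : ∀ i j → InGrid p q i j → x i j + x (suc p ∸ i) (suc q ∸ j) ≡ balanceSum K w (parity (i ℕ.+ j))
    balance i j g with parity (i ℕ.+ j) in par
    ... | 0ℙ = ℤₚ.*-cancelˡ-≡ (+ 2) _ _ (trans (bal-even i j g (parity≡0ℙ⇒even (i ℕ.+ j) par)) (even-balance≡ w pq≡))
    ... | 1ℙ = ℤₚ.*-cancelˡ-≡ (+ 2) _ _ (trans (bal-odd i j g (parity≡1ℙ⇒odd (i ℕ.+ j) par)) (odd-balance≡ M N w pq≡))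
    column : ∀ i → 1 ℕ.≤ i → i ℕ.+ 2 ℕ.≤ p →
             Ordered (parity (i ℕ.+ center q)) (x i (center q)) (x (i ℕ.+ 2) (center q))
    column i 1≤i i+2≤p with parity (i ℕ.+ center q) in par
    ... | 0ℙ = col-even i 1≤i i+2≤p (parity≡0ℙ⇒even (i ℕ.+ center q) par)
    ... | 1ℙ = col-odd i 1≤i i+2≤p (parity≡1ℙ⇒odd (i ℕ.+ center q) par)
    row : ∀ j → 1 ℕ.≤ j → j ℕ.+ 2 ℕ.≤ q →
          Ordered (parity (center p ℕ.+ j)) (x (center p) j) (x (center p) (j ℕ.+ 2))
    row j 1≤j j+2≤q with parity (center p ℕ.+ j) in par
    ... | 0ℙ = row-even j 1≤j j+2≤q (parity≡0ℙ⇒even (center p ℕ.+ j) par)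
    ... | 1ℙ = row-odd j 1≤j j+2≤q (parity≡1ℙ⇒odd (center p ℕ.+ j) par)

  Bicentral⇒PBB : ∀ {M N p q w x} → IsOdd p → IsOdd q → 3 ℕ.≤ p → 3 ℕ.≤ q → p ℕ.≤ M → q ℕ.≤ N →
    Bicentral (M ℕ.* N) p q w x → PBB M N p q x
  Bicentral⇒PBB {M} {N} {p} {q} {w} {x} p-odd q-odd p≥3 q≥3 p≤M q≤N B = record
    { p-odd    = p-odd
    ; q-odd    = q-odd
    ; p≥3      = p≥3
    ; q≥3      = q≥3
    ; p≤M      = p≤M
    ; q≤N      = q≤N
    ; face     = λ i j 1≤i i<p 1≤j j<q → trans (face i j 1≤i i<p 1≤j j<q) (sym (+[2*M*N+3]≡2*K+3 M N))
    ; even-in  = even-in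
    ; even-all = even-all
    ; odd-in   = odd-in
    ; odd-all  = odd-all
    ; bal-even = λ i j g even →
                   trans (doubled-balance i j g (even⇒parity≡0ℙ (i ℕ.+ j) even)) (sym (even-balance≡ w area))
    ; bal-odd  = λ i j g odd →
                   trans (doubled-balance i j g (odd⇒parity≡1ℙ (i ℕ.+ j) odd)) (sym (odd-balance≡ M N w area))
    ; col-even = λ i 1≤i i+2≤p even →
                   ordered-at (i ℕ.+ center q) (even⇒parity≡0ℙ (i ℕ.+ center q) even) (column i 1≤i i+2≤p)
    ; col-odd  = λ i 1≤i i+2≤p odd →
                   ordered-at (i ℕ.+ center q) (odd⇒parity≡1ℙ (i ℕ.+ center q) odd) (column i 1≤i i+2≤p)
    ; row-even = λ j 1≤j j+2≤q even →
                   ordered-at (center p ℕ.+ j) (even⇒parity≡0ℙ (center p ℕ.+ j) even) (row j 1≤j j+2≤q)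
    ; row-odd  = λ j 1≤j j+2≤q odd →
                   ordered-at (center p ℕ.+ j) (odd⇒parity≡1ℙ (center p ℕ.+ j) odd) (row j 1≤j j+2≤q)
    }
    where
    open Bicentral B
    K : ℕ
    K = M ℕ.* N
    half+1 : (p ℕ.* q ℕ.+ 1) / 2 ≡ w ℕ.+ 2
    half+1 = proj₁ (halves w area)
    half-3 : (p ℕ.* q ∸ 3) / 2 ≡ w
    half-3 = proj₂ (halves w area)
    ranked-at : ∀ {i j b} → parity (i ℕ.+ j) ≡ b → InGrid p q i j → RankIn K b 0 (labelCount w b) (x i j)
    ranked-at {i} {j} refl g = ranked i j g
    doubled-balance : ∀ i j {b} → InGrid p q i j → parity (i ℕ.+ j) ≡ b →
                      + 2 * (x i j + x (suc p ∸ i) (suc q ∸ j)) ≡ + 2 * balanceSum K w b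
    doubled-balance i j g refl = cong (+ 2 *_) (balance i j g)
    ordered-at : ∀ s {b y z} → parity s ≡ b → Ordered (parity s) y z → Ordered b y z
    ordered-at s refl o = o
    even-in : ∀ i j → InGrid p q i j → IsEven (i ℕ.+ j) → + 1 ≤ x i j × x i j ≤ + ((p ℕ.* q ℕ.+ 1) / 2)
    even-in i j g even with small-bounds {K} (ranked-at (even⇒parity≡0ℙ (i ℕ.+ j) even) g)
    ... | lo , hi = lo , subst (λ h → x i j ≤ + h) (sym half+1) hi
    even-all : ∀ y → + 1 ≤ y → y ≤ + ((p ℕ.* q ℕ.+ 1) / 2) →
               ∃₂ λ i j → InGrid p q i j × IsEven (i ℕ.+ j) × x i j ≡ y
    even-all y lo hi with onto 0ℙ y (small-rank {K} lo (subst (λ h → y ≤ + h) half+1 hi))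
    ... | i , j , g , par , x≡ = i , j , g , parity≡0ℙ⇒even (i ℕ.+ j) par , x≡
    odd-in : ∀ i j → InGrid p q i j → IsOdd (i ℕ.+ j) → + K - + ((p ℕ.* q ∸ 3) / 2) ≤ x i j × x i j ≤ + K
    odd-in i j g odd with large-bounds (ranked-at (odd⇒parity≡1ℙ (i ℕ.+ j) odd) g)
    ... | lo , hi = subst (λ h → + K - + h ≤ x i j) (sym half-3) lo , hi
    odd-all : ∀ y → + K - + ((p ℕ.* q ∸ 3) / 2) ≤ y → y ≤ + K →
              ∃₂ λ i j → InGrid p q i j × IsOdd (i ℕ.+ j) × x i j ≡ y
    odd-all y lo hi with onto 1ℙ y (large-rank (subst (λ h → + K - + h ≤ y) half-3 lo) hi)
    ... | i , j , g , par , x≡ = i , j , g , parity≡1ℙ⇒odd (i ℕ.+ j) par , x≡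

open Conversions

module Blocks (K v : ℕ) where
  open import Data.Integer using (_+_; _-_; -_; _*_; _≤_; _<_)

  blockSize : ℕ
  blockSize = 3 ℕ.+ v ℕ.* 2

  Z : ℤ
  Z = + 3 + + v * + 2

  +[k*blockSize]≡k*Z : ∀ k → + (k ℕ.* blockSize) ≡ + k * Z
  +[k*blockSize]≡k*Z k = trans (ℤₚ.pos-* k blockSize) (cong (λ a → + k * (+ 3 + a)) (ℤₚ.pos-* v 2))

  -- The formulas of HASC^r for block 2k (e = 0ℙ) and block 2k + 1 (e = 1ℙ) at a cell whose
  -- copy in X has parity p; Z = mn.
  blockLabel : Parity → ℕ → Parity → ℤ → ℤ
  blockLabel 0ℙ k 0ℙ x = x + + k * Z
  blockLabel 0ℙ k 1ℙ x = x - + k * Z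
  blockLabel 1ℙ k 0ℙ x = + K - x - (+ k * Z + + v)
  blockLabel 1ℙ k 1ℙ x = + K - x + (+ k * Z + + v + + 3)

  stackCount : Parity → ℕ → ℕ
  stackCount b 0             = 0
  stackCount b 1             = labelCount v b
  stackCount b (suc (suc t)) = blockSize ℕ.+ stackCount b t

  labelCount-sum : ∀ b → labelCount v b ℕ.+ labelCount v (b ⁻¹) ≡ blockSize
  labelCount-sum 0ℙ = sum v
    where
    sum : ∀ v → v ℕ.+ 2 ℕ.+ (v ℕ.+ 1) ≡ 3 ℕ.+ v ℕ.* 2
    sum = ℕ-Ring.solve-∀
  labelCount-sum 1ℙ = sum v
    where
    sum : ∀ v → v ℕ.+ 1 ℕ.+ (v ℕ.+ 2) ≡ 3 ℕ.+ v ℕ.* 2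
    sum = ℕ-Ring.solve-∀

  stackCount-even : ∀ b k → stackCount b (k ℕ.* 2) ≡ k ℕ.* blockSize
  stackCount-even b zero    = refl
  stackCount-even b (suc k) = cong (blockSize ℕ.+_) (stackCount-even b k)

  stackCount-odd : ∀ b k → stackCount b (suc (k ℕ.* 2)) ≡ k ℕ.* blockSize ℕ.+ labelCount v b
  stackCount-odd b zero    = refl
  stackCount-odd b (suc k) = trans (cong (blockSize ℕ.+_) (stackCount-odd b k)) (sym (ℕₚ.+-assoc blockSize _ _))

  stackCount-step : ∀ b t → stackCount b t ℕ.≤ stackCount b (suc t)
  stackCount-step b zero          = z≤n
  stackCount-step b (suc zero)    = ℕₚ.≤-trans (ℕₚ.m≤m+n _ _) (ℕₚ.≤-reflexive (sym count≡))
    where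
    count≡ : blockSize ℕ.+ 0 ≡ labelCount v b ℕ.+ labelCount v (b ⁻¹)
    count≡ = trans (ℕₚ.+-identityʳ blockSize) (sym (labelCount-sum b))
  stackCount-step b (suc (suc t)) = ℕₚ.+-monoʳ-≤ blockSize (stackCount-step b t)

  stackCount-block : ∀ e k p →
    stackCount (e ℙ.+ p) (suc (blockIndex e k)) ≡ stackCount (e ℙ.+ p) (blockIndex e k) ℕ.+ labelCount v p
  stackCount-block 0ℙ k p = trans (stackCount-odd p k) (cong (ℕ._+ labelCount v p) (sym (stackCount-even p k)))
  stackCount-block 1ℙ k p = begin
      blockSize ℕ.+ stackCount (p ⁻¹) (k ℕ.* 2)
    ≡⟨ cong (blockSize ℕ.+_) (stackCount-even (p ⁻¹) k) ⟩
      blockSize ℕ.+ k ℕ.* blockSize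
    ≡⟨ cong (λ a → a ℕ.+ k ℕ.* blockSize) (sym (labelCount-sum p)) ⟩
      labelCount v p ℕ.+ labelCount v (p ⁻¹) ℕ.+ k ℕ.* blockSize
    ≡⟨ regroup (labelCount v p) (labelCount v (p ⁻¹)) (k ℕ.* blockSize) ⟩
      k ℕ.* blockSize ℕ.+ labelCount v (p ⁻¹) ℕ.+ labelCount v p
    ≡⟨ cong (ℕ._+ labelCount v p) (sym (stackCount-odd (p ⁻¹) k)) ⟩
      stackCount (p ⁻¹) (suc (k ℕ.* 2)) ℕ.+ labelCount v p
    ∎
    where
    open ≡-Reasoning
    regroup : ∀ a b c → a ℕ.+ b ℕ.+ c ≡ c ℕ.+ b ℕ.+ a
    regroup = ℕ-Ring.solve-∀

  stackCount-next : ∀ e k b →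
    stackCount b (suc (blockIndex e k)) ≡ stackCount b (blockIndex e k) ℕ.+ labelCount v (e ℙ.+ b)
  stackCount-next e k b =
    subst (λ b′ → stackCount b′ (suc (blockIndex e k)) ≡ stackCount b′ (blockIndex e k) ℕ.+ labelCount v (e ℙ.+ b))
          (p+[p+q]≡q e b) (stackCount-block e k (e ℙ.+ b))

  stackCount-total : ∀ b c → stackCount b (suc (c ℕ.* 2)) ≡ labelCount (c ℕ.* blockSize ℕ.+ v) b
  stackCount-total 0ℙ c = trans (stackCount-odd 0ℙ c) (sym (ℕₚ.+-assoc (c ℕ.* blockSize) v 2))
  stackCount-total 1ℙ c = trans (stackCount-odd 1ℙ c) (sym (ℕₚ.+-assoc (c ℕ.* blockSize) v 1))

  blockLabel-rank : ∀ e k p u →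
    blockLabel e k p (rankedLabel K p u) ≡ rankedLabel K (e ℙ.+ p) (stackCount (e ℙ.+ p) (blockIndex e k) ℕ.+ u)
  blockLabel-rank 0ℙ k 0ℙ u rewrite stackCount-even 0ℙ k =
    trans (ℤₚ.+-comm (+ u) (+ k * Z)) (cong (_+ + u) (sym (+[k*blockSize]≡k*Z k)))
  blockLabel-rank 0ℙ k 1ℙ u rewrite stackCount-even 1ℙ k =
    trans (shift (+ K) (+ u) (+ k * Z)) (cong (λ s → + 1 + + K - (s + + u)) (sym (+[k*blockSize]≡k*Z k)))
    where
    shift : ∀ K u s → + 1 + K - u - s ≡ + 1 + K - (s + u)
    shift = solve-∀
  blockLabel-rank 1ℙ k 0ℙ u rewrite stackCount-odd 1ℙ k =
    trans (shift (+ K) (+ u) (+ k) (+ v)) (cong (λ s → + 1 + + K - (s + (+ v + + 1) + + u)) (sym (+[k*blockSize]≡k*Z k)))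
    where
    shift : ∀ K u k v → K - u - (k * (+ 3 + v * + 2) + v) ≡ + 1 + K - (k * (+ 3 + v * + 2) + (v + + 1) + u)
    shift = solve-∀
  blockLabel-rank 1ℙ k 1ℙ u rewrite stackCount-odd 0ℙ k =
    trans (shift (+ K) (+ u) (+ k) (+ v)) (cong (λ s → s + (+ v + + 2) + + u) (sym (+[k*blockSize]≡k*Z k)))
    where
    shift : ∀ K u k v → K - (+ 1 + K - u) + (k * (+ 3 + v * + 2) + v + + 3) ≡ k * (+ 3 + v * + 2) + (v + + 2) + u
    shift = solve-∀

  blockLabel-ordered : ∀ e k p {q x y} → Ordered q x y →
    Ordered (e ℙ.+ q) (blockLabel e k p x) (blockLabel e k p y)
  blockLabel-ordered 0ℙ k 0ℙ {q} = Ordered-translate q (+ k * Z)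
  blockLabel-ordered 0ℙ k 1ℙ {q} = Ordered-translate q (- (+ k * Z))
  blockLabel-ordered 1ℙ k 0ℙ {q} = Ordered-translate (q ⁻¹) (- (+ k * Z + + v)) ∘ Ordered-reflect q (+ K)
  blockLabel-ordered 1ℙ k 1ℙ {q} = Ordered-translate (q ⁻¹) (+ k * Z + + v + + 3) ∘ Ordered-reflect q (+ K)

  nextHalf : Parity → ℕ → ℕ
  nextHalf 0ℙ k = k
  nextHalf 1ℙ k = suc k

  blockIndex-next : ∀ e k → blockIndex (e ⁻¹) (nextHalf e k) ≡ suc (blockIndex e k)
  blockIndex-next 0ℙ k = refl
  blockIndex-next 1ℙ k = refl

  blockLabel-face : ∀ e k p {x₁ x₂ x₃ x₄} → x₁ + x₂ + x₃ + x₄ ≡ + 2 * + K + + 3 →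
    blockLabel e k p x₁ + blockLabel e k (p ⁻¹) x₂ + blockLabel e k (p ⁻¹) x₃ + blockLabel e k p x₄
      ≡ + 2 * + K + + 3
  blockLabel-face e k p {x₁} {x₂} {x₃} {x₄} sum with solveFor {x₁ + x₂ + x₃} {x₄} sum
  ... | refl = identity e p
    where
    S : ℤ
    S = + 2 * + K + + 3
    identity : ∀ e p → blockLabel e k p x₁ + blockLabel e k (p ⁻¹) x₂ + blockLabel e k (p ⁻¹) x₃
                       + blockLabel e k p (S - (x₁ + x₂ + x₃)) ≡ S
    identity 0ℙ 0ℙ = ring (+ K) x₁ x₂ x₃ (+ k * Z)
      where
      ring : ∀ K x₁ x₂ x₃ s → x₁ + s + (x₂ - s) + (x₃ - s) + (+ 2 * K + + 3 - (x₁ + x₂ + x₃) + s) ≡ + 2 * K + + 3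
      ring = solve-∀
    identity 0ℙ 1ℙ = ring (+ K) x₁ x₂ x₃ (+ k * Z)
      where
      ring : ∀ K x₁ x₂ x₃ s → x₁ - s + (x₂ + s) + (x₃ + s) + (+ 2 * K + + 3 - (x₁ + x₂ + x₃) - s) ≡ + 2 * K + + 3
      ring = solve-∀
    identity 1ℙ 0ℙ = ring (+ K) x₁ x₂ x₃ (+ k * Z + + v)
      where
      ring : ∀ K x₁ x₂ x₃ a → K - x₁ - a + (K - x₂ + (a + + 3)) + (K - x₃ + (a + + 3))
                              + (K - (+ 2 * K + + 3 - (x₁ + x₂ + x₃)) - a) ≡ + 2 * K + + 3
      ring = solve-∀
    identity 1ℙ 1ℙ = ring (+ K) x₁ x₂ x₃ (+ k * Z + + v)
      where
      ring : ∀ K x₁ x₂ x₃ a → K - x₁ + (a + + 3) + (K - x₂ - a) + (K - x₃ - a)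
                              + (K - (+ 2 * K + + 3 - (x₁ + x₂ + x₃)) + (a + + 3)) ≡ + 2 * K + + 3
      ring = solve-∀

  blockLabel-seam : ∀ e k p {a b c d} → a + b ≡ c + d →
    let e′ = e ⁻¹ ; k′ = nextHalf e k in
    blockLabel e k p a + blockLabel e′ k′ p c + blockLabel e k (p ⁻¹) b + blockLabel e′ k′ (p ⁻¹) d
      ≡ + 2 * + K + + 3
  blockLabel-seam e k p {a} {b} {c} {d} sum with solveFor {c} {d} (sym sum)
  ... | refl = identity e p
    where
    identity : ∀ e p → blockLabel e k p a + blockLabel (e ⁻¹) (nextHalf e k) p c + blockLabel e k (p ⁻¹) b
                       + blockLabel (e ⁻¹) (nextHalf e k) (p ⁻¹) (a + b - c) ≡ + 2 * + K + + 3
    identity 0ℙ 0ℙ = ring (+ K) a b c (+ k * Z) (+ v)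
      where
      ring : ∀ K a b c s v → a + s + (K - c - (s + v)) + (b - s) + (K - (a + b - c) + (s + v + + 3)) ≡ + 2 * K + + 3
      ring = solve-∀
    identity 0ℙ 1ℙ = ring (+ K) a b c (+ k * Z) (+ v)
      where
      ring : ∀ K a b c s v → a - s + (K - c + (s + v + + 3)) + (b + s) + (K - (a + b - c) - (s + v)) ≡ + 2 * K + + 3
      ring = solve-∀
    identity 1ℙ 0ℙ = ring (+ K) a b c (+ k) (+ v)
      where
      ring : ∀ K a b c k v → K - a - (k * (+ 3 + v * + 2) + v) + (c + (+ 1 + k) * (+ 3 + v * + 2))
                             + (K - b + (k * (+ 3 + v * + 2) + v + + 3)) + (a + b - c - (+ 1 + k) * (+ 3 + v * + 2))
                             ≡ + 2 * K + + 3
      ring = solve-∀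
    identity 1ℙ 1ℙ = ring (+ K) a b c (+ k) (+ v)
      where
      ring : ∀ K a b c k v → K - a + (k * (+ 3 + v * + 2) + v + + 3) + (c - (+ 1 + k) * (+ 3 + v * + 2))
                             + (K - b - (k * (+ 3 + v * + 2) + v)) + (a + b - c + (+ 1 + k) * (+ 3 + v * + 2))
                             ≡ + 2 * K + + 3
      ring = solve-∀

  blockLabel-balance : ∀ e k k′ c p {x x′} → blockIndex e k ℕ.+ blockIndex e k′ ≡ c ℕ.* 2 →
    x + x′ ≡ balanceSum K v p →
    blockLabel e k p x + blockLabel e k′ p x′ ≡ balanceSum K (c ℕ.* blockSize ℕ.+ v) (e ℙ.+ p)
  blockLabel-balance 0ℙ k k′ c p {x} {x′} indices sum
    with refl ← blockIndex-sum-0ℙ k k′ c indices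
    with refl ← solveFor {x} {x′} sum = identity p
    where
    +[k+k′]*blockSize : + (k ℕ.+ k′) * Z ≡ + ((k ℕ.+ k′) ℕ.* blockSize)
    +[k+k′]*blockSize = sym (+[k*blockSize]≡k*Z (k ℕ.+ k′))
    identity : ∀ p → blockLabel 0ℙ k p x + blockLabel 0ℙ k′ p (balanceSum K v p - x)
                     ≡ balanceSum K ((k ℕ.+ k′) ℕ.* blockSize ℕ.+ v) p
    identity 0ℙ = trans (ring x (+ v) (+ k) (+ k′) Z) (cong (λ s → s + + v + + 3) +[k+k′]*blockSize)
      where
      ring : ∀ x v k k′ z → x + k * z + (v + + 3 - x + k′ * z) ≡ (k + k′) * z + v + + 3
      ring = solve-∀
    identity 1ℙ = trans (ring x (+ K) (+ v) (+ k) (+ k′) Z) (cong (λ s → + 2 * + K - (s + + v)) +[k+k′]*blockSize)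
      where
      ring : ∀ x K v k k′ z → x - k * z + (+ 2 * K - v - x - k′ * z) ≡ + 2 * K - ((k + k′) * z + v)
      ring = solve-∀
  blockLabel-balance 1ℙ k k′ c p {x} {x′} indices sum
    with refl ← blockIndex-sum-1ℙ k k′ c indices
    with refl ← solveFor {x} {x′} sum = identity p
    where
    +[1+k+k′]*blockSize : + suc (k ℕ.+ k′) * Z ≡ + (suc (k ℕ.+ k′) ℕ.* blockSize)
    +[1+k+k′]*blockSize = sym (+[k*blockSize]≡k*Z (suc (k ℕ.+ k′)))
    identity : ∀ p → blockLabel 1ℙ k p x + blockLabel 1ℙ k′ p (balanceSum K v p - x)
                     ≡ balanceSum K (suc (k ℕ.+ k′) ℕ.* blockSize ℕ.+ v) (p ⁻¹)
    identity 0ℙ = trans (ring x (+ K) (+ v) (+ k) (+ k′)) (cong (λ s → + 2 * + K - (s + + v)) +[1+k+k′]*blockSize)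
      where
      ring : ∀ x K v k k′ → K - x - (k * (+ 3 + v * + 2) + v) + (K - (v + + 3 - x) - (k′ * (+ 3 + v * + 2) + v))
                            ≡ + 2 * K - ((+ 1 + (k + k′)) * (+ 3 + v * + 2) + v)
      ring = solve-∀
    identity 1ℙ = trans (ring x (+ K) (+ v) (+ k) (+ k′)) (cong (λ s → s + + v + + 3) +[1+k+k′]*blockSize)
      where
      ring : ∀ x K v k k′ → K - x + (k * (+ 3 + v * + 2) + v + + 3)
                            + (K - (+ 2 * K - v - x) + (k′ * (+ 3 + v * + 2) + v + + 3))
                            ≡ (+ 1 + (k + k′)) * (+ 3 + v * + 2) + v + + 3
      ring = solve-∀

  BlockStack : (m n c : ℕ) (X Y : Label) → Set
  BlockStack m n c X Y = ∀ e k i j → InGrid m n i j → blockIndex e k ℕ.≤ c ℕ.* 2 →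
    Y (blockIndex e k ℕ.* m ℕ.+ i) j ≡ blockLabel e k (parity (i ℕ.+ j)) (X i j)

module _ (M N : ℕ) {m n v : ℕ} (mn≡ : m ℕ.* n ≡ 3 ℕ.+ v ℕ.* 2) where
  open import Data.Integer using (_+_; _-_; -_; _*_; _≤_; _<_)
  open Blocks (M ℕ.* N) v

  +[t*m*n]≡t*Z : ∀ t → + (t ℕ.* m ℕ.* n) ≡ + t * Z
  +[t*m*n]≡t*Z t = trans (cong +_ (trans (ℕₚ.*-assoc t m n) (cong (t ℕ.*_) mn≡))) (+[k*blockSize]≡k*Z t)

  +[suc[k*2]*m*n]≡[1+k*2]*Z : ∀ k → + (suc (k ℕ.* 2) ℕ.* m ℕ.* n) ≡ (+ 1 + + k * + 2) * Z
  +[suc[k*2]*m*n]≡[1+k*2]*Z k = trans (+[t*m*n]≡t*Z (suc (k ℕ.* 2))) (cong (λ s → (+ 1 + s) * Z) (ℤₚ.pos-* k 2))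

  shifted-copy : ∀ k i j {x y} →
    (IsOdd (i ℕ.+ j) → y ≡ x - + (k ℕ.* m ℕ.* n)) × (IsEven (i ℕ.+ j) → y ≡ x + + (k ℕ.* m ℕ.* n)) →
    y ≡ blockLabel 0ℙ k (parity (i ℕ.+ j)) x
  shifted-copy k i j {x} (odd , even) with parity (i ℕ.+ j) in par
  ... | 0ℙ = trans (even (parity≡0ℙ⇒even (i ℕ.+ j) par)) (cong (λ s → x + s) (+[t*m*n]≡t*Z k))
  ... | 1ℙ = trans (odd (parity≡1ℙ⇒odd (i ℕ.+ j) par)) (cong (λ s → x - s) (+[t*m*n]≡t*Z k))

  reflected-copy : ∀ k i j {t x y} → t ≡ suc (k ℕ.* 2) →
    (IsOdd (i ℕ.+ j) → + 2 * y ≡ + (2 ℕ.* M ℕ.* N) - + 2 * x + + (t ℕ.* m ℕ.* n) + + 3) ×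
    (IsEven (i ℕ.+ j) → + 2 * y ≡ + (2 ℕ.* M ℕ.* N) - + 2 * x - + (t ℕ.* m ℕ.* n) + + 3) →
    y ≡ blockLabel 1ℙ k (parity (i ℕ.+ j)) x
  reflected-copy k i j {x = x} {y} refl (odd , even) with parity (i ℕ.+ j) in par
  ... | 0ℙ = ℤₚ.*-cancelˡ-≡ (+ 2) y _
               (trans (even (parity≡0ℙ⇒even (i ℕ.+ j) par))
                      (trans (cong₂ (λ K s → K - + 2 * x - s + + 3) (+[2*M*N]≡2*K M N) (+[suc[k*2]*m*n]≡[1+k*2]*Z k))
                             (halve (+ (M ℕ.* N)) x (+ k) (+ v))))
    where
    halve : ∀ K x k v → + 2 * K - + 2 * x - (+ 1 + k * + 2) * (+ 3 + v * + 2) + + 3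
                        ≡ + 2 * (K - x - (k * (+ 3 + v * + 2) + v))
    halve = solve-∀
  ... | 1ℙ = ℤₚ.*-cancelˡ-≡ (+ 2) y _
               (trans (odd (parity≡1ℙ⇒odd (i ℕ.+ j) par))
                      (trans (cong₂ (λ K s → K - + 2 * x + s + + 3) (+[2*M*N]≡2*K M N) (+[suc[k*2]*m*n]≡[1+k*2]*Z k))
                             (halve (+ (M ℕ.* N)) x (+ k) (+ v))))
    where
    halve : ∀ K x k v → + 2 * K - + 2 * x + (+ 1 + k * + 2) * (+ 3 + v * + 2) + + 3
                        ≡ + 2 * (K - x + (k * (+ 3 + v * + 2) + v + + 3))
    halve = solve-∀

  ASCRel⇒blockLabel : ∀ {c pos x y} → ASCRel M N m n (suc (c ℕ.* 2)) pos x y →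
    ∀ e k i j → InGrid m n i j → blockIndex e k ℕ.≤ c ℕ.* 2 →
    y (proj₁ (pos (blockIndex e k) i j)) (proj₂ (pos (blockIndex e k) i j)) ≡ blockLabel e k (parity (i ℕ.+ j)) (x i j)
  ASCRel⇒blockLabel {c} {pos} {x} {y} rel 0ℙ k i j g t≤ =
    subst (λ t → y (proj₁ (pos t i j)) (proj₂ (pos t i j)) ≡ blockLabel 0ℙ k (parity (i ℕ.+ j)) (x i j))
          (ℕₚ.*-comm 2 k) (shifted-copy k i j (proj₂ (rel i j g) k k≤c))
    where
    k≤c : k ℕ.≤ suc (c ℕ.* 2) / 2
    k≤c = subst (k ℕ.≤_) (sym (suc[n*2]/2≡n c)) (ℕₚ.*-cancelʳ-≤ k c 2 t≤)
  ASCRel⇒blockLabel {c} {pos} {x} {y} rel 1ℙ k i j g t≤ =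
    subst (λ t → y (proj₁ (pos t i j)) (proj₂ (pos t i j)) ≡ blockLabel 1ℙ k (parity (i ℕ.+ j)) (x i j))
          t≡ (reflected-copy k i j t≡ (proj₁ (rel i j g) (suc k) (s≤s z≤n) k<c))
    where
    double : ∀ k → 2 ℕ.* suc k ≡ suc (suc (k ℕ.* 2))
    double = ℕ-Ring.solve-∀
    t≡ : 2 ℕ.* suc k ∸ 1 ≡ suc (k ℕ.* 2)
    t≡ = cong (_∸ 1) (double k)
    k<c : suc k ℕ.≤ suc (c ℕ.* 2) / 2
    k<c = subst (suc k ℕ.≤_) (sym (suc[n*2]/2≡n c)) (ℕₚ.*-cancelʳ-< 2 k c t≤)

  IsHASC⇒BlockStack : ∀ c X Y → IsHASC M N m n (suc (c ℕ.* 2)) X Y → BlockStack m n c X Y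
  IsHASC⇒BlockStack c X Y = ASCRel⇒blockLabel {c} {λ t i j → (t ℕ.* m ℕ.+ i , j)} {X} {Y}

  IsVASC⇒BlockStack : ∀ c X Y → IsVASC M N m n (suc (c ℕ.* 2)) X Y → BlockStack n m c (transpose X) (transpose Y)
  IsVASC⇒BlockStack c X Y vasc e k j i g t≤ =
    trans (ASCRel⇒blockLabel {c} {λ t i j → (i , t ℕ.* n ℕ.+ j)} {X} {Y} vasc e k i j (InGrid-transpose g) t≤)
          (cong (λ b → blockLabel e k b (X i j)) (parity-comm i j))

module Stacking {K m n v : ℕ} {X : Label} (B : Bicentral K m n v X)
                (m-odd : parity m ≡ 1ℙ) (n-odd : parity n ≡ 1ℙ) (3≤m : 3 ℕ.≤ m)
                (c : ℕ) {Y : Label} (stack : Blocks.BlockStack K v m n c X Y) where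
  open import Data.Integer using (_+_; _-_; -_; _*_; _≤_; _<_)
  open Bicentral B
  open Blocks K v

  r : ℕ
  r = suc (c ℕ.* 2)

  W : ℕ
  W = c ℕ.* blockSize ℕ.+ v

  instance
    m≢0 : NonZero m
    m≢0 = ℕ.>-nonZero (ℕₚ.<-≤-trans (s≤s z≤n) 3≤m)

  record BlockCell (I j : ℕ) : Set where
    constructor blockCell
    field
      e       : Parity
      k       : ℕ
      i       : ℕ
      row     : I ≡ blockIndex e k ℕ.* m ℕ.+ i
      inX     : InGrid m n i j
      inStack : blockIndex e k ℕ.≤ c ℕ.* 2

  decode : ∀ {I j} → InGrid (m ℕ.* r) n I j → BlockCell I j
  decode {I} {j} (1≤I , I≤mr , 1≤j , j≤n) with row-decomposition m r I 1≤I I≤mr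
  ... | t , i , I≡ , 1≤i , i≤m , t<r with blockIndex-surjective t
  ... | e , k , refl = blockCell e k i I≡ (1≤i , i≤m , 1≤j , j≤n) (ℕₚ.≤-pred t<r)

  encode : ∀ e k i j → InGrid m n i j → blockIndex e k ℕ.≤ c ℕ.* 2 → InGrid (m ℕ.* r) n (blockIndex e k ℕ.* m ℕ.+ i) j
  encode e k i j (1≤i , i≤m , 1≤j , j≤n) t≤ =
    ℕₚ.≤-trans 1≤i (ℕₚ.m≤n+m i _) , I≤mr , 1≤j , j≤n
    where
    I≤mr : blockIndex e k ℕ.* m ℕ.+ i ℕ.≤ m ℕ.* r
    I≤mr = ℕₚ.≤-trans (ℕₚ.+-monoʳ-≤ _ i≤m)
             (ℕₚ.≤-trans (ℕₚ.≤-reflexive (ℕₚ.+-comm _ m)) (ℕₚ.≤-trans (ℕₚ.*-monoˡ-≤ m (s≤s t≤)) (ℕₚ.≤-reflexive (ℕₚ.*-comm r m))))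

  cell-parity : ∀ e k i j → parity (blockIndex e k ℕ.* m ℕ.+ i ℕ.+ j) ≡ e ℙ.+ parity (i ℕ.+ j)
  cell-parity e k i j = begin
      parity (blockIndex e k ℕ.* m ℕ.+ i ℕ.+ j)
    ≡⟨ cong parity (ℕₚ.+-assoc (blockIndex e k ℕ.* m) i j) ⟩
      parity (blockIndex e k ℕ.* m ℕ.+ (i ℕ.+ j))
    ≡⟨ ℙₚ.+-homo-+ (blockIndex e k ℕ.* m) (i ℕ.+ j) ⟩
      parity (blockIndex e k ℕ.* m) ℙ.+ parity (i ℕ.+ j)
    ≡⟨ cong (ℙ._+ parity (i ℕ.+ j)) (ℙₚ.*-homo-* (blockIndex e k) m) ⟩
      parity (blockIndex e k) ℙ.* parity m ℙ.+ parity (i ℕ.+ j)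
    ≡⟨ cong₂ (λ a b → a ℙ.* b ℙ.+ parity (i ℕ.+ j)) (parity-blockIndex e k) m-odd ⟩
      e ℙ.* 1ℙ ℙ.+ parity (i ℕ.+ j)
    ≡⟨ cong (ℙ._+ parity (i ℕ.+ j)) (ℙₚ.*-identityʳ e) ⟩
      e ℙ.+ parity (i ℕ.+ j)
    ∎
    where open ≡-Reasoning

  Y-at : ∀ e k i j p → InGrid m n i j → blockIndex e k ℕ.≤ c ℕ.* 2 → parity (i ℕ.+ j) ≡ p →
    Y (blockIndex e k ℕ.* m ℕ.+ i) j ≡ blockLabel e k p (X i j)
  Y-at e k i j p g t≤ refl = stack e k i j g t≤

  Y-rank : ∀ {I j} (C : BlockCell I j) → let open BlockCell C; b = parity (I ℕ.+ j) in
    RankIn K b (stackCount b (blockIndex e k)) (stackCount b (suc (blockIndex e k))) (Y I j)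
  Y-rank {I} {j} (blockCell e k i refl g t≤) with ranked i j g
  ... | u , 0<u , u≤ , X≡ rewrite cell-parity e k i j =
    stackCount b t ℕ.+ u , ℕₚ.m<m+n _ 0<u ,
    ℕₚ.≤-trans (ℕₚ.+-monoʳ-≤ _ u≤) (ℕₚ.≤-reflexive (sym (stackCount-block e k p))) ,
    trans (stack e k i j g t≤) (trans (cong (blockLabel e k p) X≡) (blockLabel-rank e k p u))
    where
    p : Parity
    p = parity (i ℕ.+ j)
    b : Parity
    b = e ℙ.+ p
    t : ℕ
    t = blockIndex e k

  Y-range : ∀ I j → InGrid (m ℕ.* r) n I j →
    RankIn K (parity (I ℕ.+ j)) 0 (labelCount W (parity (I ℕ.+ j))) (Y I j)
  Y-range I j g with decode g
  ... | C@(blockCell e k i _ _ t≤) with Y-rank C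
  ... | u , lo<u , u≤hi , Y≡ =
    u , ℕₚ.≤-<-trans z≤n lo<u , ℕₚ.≤-trans u≤hi hi≤total , Y≡
    where
    b : Parity
    b = parity (I ℕ.+ j)
    hi≤total : stackCount b (suc (blockIndex e k)) ℕ.≤ labelCount W b
    hi≤total = ℕₚ.≤-trans (stepwise-mono (stackCount b) (stackCount-step b) (s≤s t≤))
                          (ℕₚ.≤-reflexive (stackCount-total b c))

  block-onto : ∀ e k b u → 0 ℕ.< u → u ℕ.≤ labelCount v (e ℙ.+ b) → blockIndex e k ℕ.≤ c ℕ.* 2 →
    ∃₂ λ I j → InGrid (m ℕ.* r) n I j × parity (I ℕ.+ j) ≡ b ×
               Y I j ≡ rankedLabel K b (stackCount b (blockIndex e k) ℕ.+ u)
  block-onto e k b u 0<u u≤ t≤ with onto (e ℙ.+ b) _ (u , 0<u , u≤ , refl)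
  ... | i , j , g , par , X≡ = blockIndex e k ℕ.* m ℕ.+ i , j , encode e k i j g t≤ , Y-parity , Y≡
    where
    Y-parity : parity (blockIndex e k ℕ.* m ℕ.+ i ℕ.+ j) ≡ b
    Y-parity = trans (cell-parity e k i j) (trans (cong (e ℙ.+_) par) (p+[p+q]≡q e b))
    Y≡ : Y (blockIndex e k ℕ.* m ℕ.+ i) j ≡ rankedLabel K b (stackCount b (blockIndex e k) ℕ.+ u)
    Y≡ = begin
        Y (blockIndex e k ℕ.* m ℕ.+ i) j
      ≡⟨ Y-at e k i j (e ℙ.+ b) g t≤ par ⟩
        blockLabel e k (e ℙ.+ b) (X i j)
      ≡⟨ cong (blockLabel e k (e ℙ.+ b)) X≡ ⟩
        blockLabel e k (e ℙ.+ b) (rankedLabel K (e ℙ.+ b) u)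
      ≡⟨ blockLabel-rank e k (e ℙ.+ b) u ⟩
        rankedLabel K (e ℙ.+ (e ℙ.+ b)) (stackCount (e ℙ.+ (e ℙ.+ b)) (blockIndex e k) ℕ.+ u)
      ≡⟨ cong (λ b′ → rankedLabel K b′ (stackCount b′ (blockIndex e k) ℕ.+ u)) (p+[p+q]≡q e b) ⟩
        rankedLabel K b (stackCount b (blockIndex e k) ℕ.+ u)
      ∎
      where open ≡-Reasoning

  Y-onto : ∀ b y → RankIn K b 0 (labelCount W b) y →
    ∃₂ λ I j → InGrid (m ℕ.* r) n I j × parity (I ℕ.+ j) ≡ b × Y I j ≡ y
  Y-onto b y (u , 0<u , u≤ , refl)
    with t , t<r , lo<u , u≤hi ← stepwise-locate (stackCount b) (stackCount-step b) r u 0<u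
                                   (subst (u ℕ.≤_) (sym (stackCount-total b c)) u≤)
    with e , k , refl ← blockIndex-surjective t
    with I , j , g , par , Y≡ ← block-onto e k b (u ∸ stackCount b t) (ℕₚ.m<n⇒0<n∸m lo<u)
                                   (ℕₚ.m≤n+o⇒m∸n≤o u _ (subst (u ℕ.≤_) (stackCount-next e k b) u≤hi))
                                   (ℕₚ.≤-pred t<r)
    = I , j , g , par , trans Y≡ (cong (rankedLabel K b) (ℕₚ.m+[n∸m]≡n (ℕₚ.<⇒≤ lo<u)))

  inStack-of-row : ∀ t i → 1 ℕ.≤ i → t ℕ.* m ℕ.+ i ℕ.≤ m ℕ.* r → t ℕ.≤ c ℕ.* 2
  inStack-of-row t i 1≤i I≤mr = ℕₚ.≤-pred (ℕₚ.*-cancelʳ-< m t r tm<rm)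
    where
    tm<rm : t ℕ.* m ℕ.< r ℕ.* m
    tm<rm = ℕₚ.<-≤-trans (ℕₚ.m<m+n _ 1≤i) (ℕₚ.≤-trans I≤mr (ℕₚ.≤-reflexive (ℕₚ.*-comm m r)))

  m≡suc[h*2] : ∃ λ h → m ≡ suc (h ℕ.* 2)
  m≡suc[h*2] = parity≡1ℙ⇒suc[h*2] m m-odd

  rowPair-top : ∀ j → 1 ℕ.≤ j → suc j ℕ.≤ n → X m j + X m (suc j) ≡ X 1 j + X 1 (suc j)
  rowPair-top j 1≤j j<n with m≡suc[h*2]
  ... | h , refl = rowPair-periodic {x = X} face h j ℕₚ.≤-refl 1≤j j<n

  parity-m+ : ∀ j → parity (m ℕ.+ j) ≡ parity (suc j)
  parity-m+ j = trans (ℙₚ.+-homo-+ m j) (trans (cong (ℙ._+ parity j) m-odd) (sym (parity-suc j)))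

  inner-face : ∀ e k i j → 1 ℕ.≤ i → suc i ℕ.≤ m → 1 ℕ.≤ j → suc j ℕ.≤ n → blockIndex e k ℕ.≤ c ℕ.* 2 →
    let I = blockIndex e k ℕ.* m ℕ.+ i in
    Y I j + Y (suc I) j + Y I (suc j) + Y (suc I) (suc j) ≡ + 2 * + K + + 3
  inner-face e k i j 1≤i i<m 1≤j j<n t≤ = begin
      Y I j + Y (suc I) j + Y I (suc j) + Y (suc I) (suc j)
    ≡⟨ cong (λ I′ → Y I j + Y I′ j + Y I (suc j) + Y I′ (suc j)) (sym (ℕₚ.+-suc tm i)) ⟩
      Y I j + Y (tm ℕ.+ suc i) j + Y I (suc j) + Y (tm ℕ.+ suc i) (suc j)
    ≡⟨ sum₄-cong (Y-at e k i j p (1≤i , ℕₚ.<⇒≤ i<m , 1≤j , ℕₚ.<⇒≤ j<n) t≤ refl)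
                 (Y-at e k (suc i) j (p ⁻¹) (s≤s z≤n , i<m , 1≤j , ℕₚ.<⇒≤ j<n) t≤ (parity-suc (i ℕ.+ j)))
                 (Y-at e k i (suc j) (p ⁻¹) (1≤i , ℕₚ.<⇒≤ i<m , s≤s z≤n , j<n) t≤
                       (trans (cong parity (ℕₚ.+-suc i j)) (parity-suc (i ℕ.+ j))))
                 (Y-at e k (suc i) (suc j) p (s≤s z≤n , i<m , s≤s z≤n , j<n) t≤
                       (cong (parity ∘ suc) (ℕₚ.+-suc i j))) ⟩
      blockLabel e k p (X i j) + blockLabel e k (p ⁻¹) (X (suc i) j)
        + blockLabel e k (p ⁻¹) (X i (suc j)) + blockLabel e k p (X (suc i) (suc j))
    ≡⟨ blockLabel-face e k p (face i j 1≤i i<m 1≤j j<n) ⟩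
      + 2 * + K + + 3
    ∎
    where
    open ≡-Reasoning
    tm : ℕ
    tm = blockIndex e k ℕ.* m
    I : ℕ
    I = tm ℕ.+ i
    p : Parity
    p = parity (i ℕ.+ j)

  seam-face : ∀ e k j → 1 ℕ.≤ j → suc j ℕ.≤ n → blockIndex e k ℕ.≤ c ℕ.* 2 →
    let I = blockIndex e k ℕ.* m ℕ.+ m in suc I ℕ.≤ m ℕ.* r →
    Y I j + Y (suc I) j + Y I (suc j) + Y (suc I) (suc j) ≡ + 2 * + K + + 3
  seam-face e k j 1≤j j<n t≤ I<mr = begin
      Y I j + Y (suc I) j + Y I (suc j) + Y (suc I) (suc j)
    ≡⟨ cong (λ I′ → Y I j + Y I′ j + Y I (suc j) + Y I′ (suc j)) next-row ⟩
      Y I j + Y I′ j + Y I (suc j) + Y I′ (suc j)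
    ≡⟨ sum₄-cong (Y-at e k m j p (m≥1 , ℕₚ.≤-refl , 1≤j , j≤n) t≤ refl)
                 (Y-at e′ k′ 1 j p (s≤s z≤n , m≥1 , 1≤j , j≤n) t′≤ (sym (parity-m+ j)))
                 (Y-at e k m (suc j) (p ⁻¹) (m≥1 , ℕₚ.≤-refl , s≤s z≤n , j<n) t≤ m+suc-j)
                 (Y-at e′ k′ 1 (suc j) (p ⁻¹) (s≤s z≤n , m≥1 , s≤s z≤n , j<n) t′≤ suc-suc-j) ⟩
      blockLabel e k p (X m j) + blockLabel e′ k′ p (X 1 j)
        + blockLabel e k (p ⁻¹) (X m (suc j)) + blockLabel e′ k′ (p ⁻¹) (X 1 (suc j))
    ≡⟨ blockLabel-seam e k p (rowPair-top j 1≤j j<n) ⟩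
      + 2 * + K + + 3
    ∎
    where
    open ≡-Reasoning
    I : ℕ
    I = blockIndex e k ℕ.* m ℕ.+ m
    e′ : Parity
    e′ = e ⁻¹
    k′ : ℕ
    k′ = nextHalf e k
    I′ : ℕ
    I′ = blockIndex e′ k′ ℕ.* m ℕ.+ 1
    p : Parity
    p = parity (m ℕ.+ j)
    m≥1 : 1 ℕ.≤ m
    m≥1 = ℕₚ.≤-trans (s≤s z≤n) 3≤m
    j≤n : j ℕ.≤ n
    j≤n = ℕₚ.<⇒≤ j<n
    spread : ∀ a m → suc (a ℕ.+ m) ≡ m ℕ.+ a ℕ.+ 1
    spread = ℕ-Ring.solve-∀
    next-row : suc I ≡ I′
    next-row = trans (spread (blockIndex e k ℕ.* m) m) (cong (λ t → t ℕ.* m ℕ.+ 1) (sym (blockIndex-next e k)))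
    t′≤ : blockIndex e′ k′ ℕ.≤ c ℕ.* 2
    t′≤ = inStack-of-row (blockIndex e′ k′) 1 (s≤s z≤n) (subst (ℕ._≤ m ℕ.* r) next-row I<mr)
    p⁻¹≡ : p ⁻¹ ≡ parity j
    p⁻¹≡ = trans (cong _⁻¹ (parity-m+ j)) (ℙₚ.suc-homo-⁻¹ j)
    m+suc-j : parity (m ℕ.+ suc j) ≡ p ⁻¹
    m+suc-j = trans (parity-m+ (suc j)) (sym p⁻¹≡)
    suc-suc-j : parity (1 ℕ.+ suc j) ≡ p ⁻¹
    suc-suc-j = sym p⁻¹≡

  Y-face : FaceMagic (m ℕ.* r) n (+ 2 * + K + + 3) Y
  Y-face I j 1≤I I<mr 1≤j j<n with decode (1≤I , ℕₚ.<⇒≤ I<mr , 1≤j , ℕₚ.<⇒≤ j<n)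
  ... | blockCell e k i refl (1≤i , i≤m , _) t≤ with ℕₚ.m≤n⇒m<n∨m≡n i≤m
  ... | inj₁ i<m  = inner-face e k i j 1≤i i<m 1≤j j<n t≤
  ... | inj₂ refl = seam-face e k j 1≤j j<n t≤ I<mr

  Y-balance : ∀ I j → InGrid (m ℕ.* r) n I j →
    Y I j + Y (suc (m ℕ.* r) ∸ I) (suc n ∸ j) ≡ balanceSum K W (parity (I ℕ.+ j))
  Y-balance I j g with decode g
  ... | blockCell e k i refl gX@(_ , i≤m , _ , j≤n) t≤ with mirror-block e k c t≤
  ... | k′ , indices = begin
      Y (t ℕ.* m ℕ.+ i) j + Y (suc (m ℕ.* r) ∸ (t ℕ.* m ℕ.+ i)) (suc n ∸ j)
    ≡⟨ cong (λ I′ → Y (t ℕ.* m ℕ.+ i) j + Y I′ (suc n ∸ j)) (mirror-row m c t t′ i indices (ℕₚ.m≤n⇒m≤1+n i≤m)) ⟩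
      Y (t ℕ.* m ℕ.+ i) j + Y (t′ ℕ.* m ℕ.+ (suc m ∸ i)) (suc n ∸ j)
    ≡⟨ cong₂ _+_ (Y-at e k i j p gX t≤ refl)
                 (Y-at e k′ (suc m ∸ i) (suc n ∸ j) p (mirror-InGrid gX) t′≤
                       (mirror-parity i j (trans m-odd (sym n-odd)) (ℕₚ.m≤n⇒m≤1+n i≤m) (ℕₚ.m≤n⇒m≤1+n j≤n))) ⟩
      blockLabel e k p (X i j) + blockLabel e k′ p (X (suc m ∸ i) (suc n ∸ j))
    ≡⟨ blockLabel-balance e k k′ c p indices (balance i j gX) ⟩
      balanceSum K W (e ℙ.+ p)
    ≡⟨ cong (balanceSum K W) (sym (cell-parity e k i j)) ⟩
      balanceSum K W (parity (t ℕ.* m ℕ.+ i ℕ.+ j))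
    ∎
    where
    open ≡-Reasoning
    t : ℕ
    t = blockIndex e k
    t′ : ℕ
    t′ = blockIndex e k′
    p : Parity
    p = parity (i ℕ.+ j)
    t′≤ : t′ ℕ.≤ c ℕ.* 2
    t′≤ = subst (t′ ℕ.≤_) indices (ℕₚ.m≤n+m t′ t)

  cn : ℕ
  cn = center n

  cn∈[1,n] : 1 ℕ.≤ cn × cn ℕ.≤ n
  cn∈[1,n] = center-bounds n n-odd

  Y-ordered : ∀ e k {i j i′ j′} → InGrid m n i j → InGrid m n i′ j′ → blockIndex e k ℕ.≤ c ℕ.* 2 →
    parity (i′ ℕ.+ j′) ≡ parity (i ℕ.+ j) → Ordered (parity (i ℕ.+ j)) (X i j) (X i′ j′) →
    let tm = blockIndex e k ℕ.* m in Ordered (parity (tm ℕ.+ i ℕ.+ j)) (Y (tm ℕ.+ i) j) (Y (tm ℕ.+ i′) j′)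
  Y-ordered e k {i} {j} {i′} {j′} g g′ t≤ par ordered =
    subst (λ b → Ordered b (Y (tm ℕ.+ i) j) (Y (tm ℕ.+ i′) j′)) (sym (cell-parity e k i j))
      (subst₂ (Ordered (e ℙ.+ p)) (sym (Y-at e k i j p g t≤ refl)) (sym (Y-at e k i′ j′ p g′ t≤ par))
              (blockLabel-ordered e k p ordered))
    where
    tm : ℕ
    tm = blockIndex e k ℕ.* m
    p : Parity
    p = parity (i ℕ.+ j)

  within-block : ∀ e k i → 1 ℕ.≤ i → i ℕ.+ 2 ℕ.≤ m → blockIndex e k ℕ.≤ c ℕ.* 2 →
    let I = blockIndex e k ℕ.* m ℕ.+ i in Ordered (parity (I ℕ.+ cn)) (Y I cn) (Y (I ℕ.+ 2) cn)
  within-block e k i 1≤i i+2≤m t≤ =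
    subst (λ I′ → Ordered (parity (tm ℕ.+ i ℕ.+ cn)) (Y (tm ℕ.+ i) cn) (Y I′ cn)) (sym (ℕₚ.+-assoc tm i 2))
          (Y-ordered e k (1≤i , ℕₚ.≤-trans (ℕₚ.m≤m+n i 2) i+2≤m , cn∈[1,n])
                         (ℕₚ.≤-trans 1≤i (ℕₚ.m≤m+n i 2) , i+2≤m , cn∈[1,n]) t≤
                         (parity-+2ˡ i cn) (column i 1≤i i+2≤m))
    where
    tm : ℕ
    tm = blockIndex e k ℕ.* m

  across-blocks : ∀ e k i → 1 ℕ.≤ i → i ℕ.≤ m → m ℕ.< i ℕ.+ 2 → blockIndex e k ℕ.≤ c ℕ.* 2 →
    let I = blockIndex e k ℕ.* m ℕ.+ i in I ℕ.+ 2 ℕ.≤ m ℕ.* r →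
    Ordered (parity (I ℕ.+ cn)) (Y I cn) (Y (I ℕ.+ 2) cn)
  across-blocks e k i 1≤i i≤m m<i+2 t≤ I+2≤mr = RankIn-ordered lower upper
    where
    I : ℕ
    I = blockIndex e k ℕ.* m ℕ.+ i
    e′ : Parity
    e′ = e ⁻¹
    k′ : ℕ
    k′ = nextHalf e k
    i′ : ℕ
    i′ = i ℕ.+ 2 ∸ m
    b : Parity
    b = parity (I ℕ.+ cn)
    i′≤m : i′ ℕ.≤ m
    i′≤m = ℕₚ.≤-trans (ℕₚ.m≤n+o⇒m∸n≤o (i ℕ.+ 2) m (ℕₚ.+-monoˡ-≤ 2 i≤m))
                      (ℕₚ.≤-trans (s≤s (s≤s z≤n)) 3≤m)
    shift : ∀ a m i′ → a ℕ.+ (m ℕ.+ i′) ≡ m ℕ.+ a ℕ.+ i′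
    shift = ℕ-Ring.solve-∀
    next-row : I ℕ.+ 2 ≡ blockIndex e′ k′ ℕ.* m ℕ.+ i′
    next-row = begin
        I ℕ.+ 2                                ≡⟨ ℕₚ.+-assoc (blockIndex e k ℕ.* m) i 2 ⟩
        blockIndex e k ℕ.* m ℕ.+ (i ℕ.+ 2)     ≡⟨ cong (blockIndex e k ℕ.* m ℕ.+_) (sym (ℕₚ.m+[n∸m]≡n (ℕₚ.<⇒≤ m<i+2))) ⟩
        blockIndex e k ℕ.* m ℕ.+ (m ℕ.+ i′)    ≡⟨ shift (blockIndex e k ℕ.* m) m i′ ⟩
        suc (blockIndex e k) ℕ.* m ℕ.+ i′      ≡⟨ cong (λ t → t ℕ.* m ℕ.+ i′) (sym (blockIndex-next e k)) ⟩
        blockIndex e′ k′ ℕ.* m ℕ.+ i′          ∎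
      where open ≡-Reasoning
    1≤i′ : 1 ℕ.≤ i′
    1≤i′ = ℕₚ.m<n⇒0<n∸m m<i+2
    t′≤ : blockIndex e′ k′ ℕ.≤ c ℕ.* 2
    t′≤ = inStack-of-row (blockIndex e′ k′) i′ 1≤i′ (subst (ℕ._≤ m ℕ.* r) next-row I+2≤mr)
    lower : RankIn K b (stackCount b (blockIndex e k)) (stackCount b (suc (blockIndex e k))) (Y I cn)
    lower = Y-rank (blockCell e k i refl (1≤i , i≤m , cn∈[1,n]) t≤)
    upper : RankIn K b (stackCount b (suc (blockIndex e k))) (stackCount b (suc (suc (blockIndex e k)))) (Y (I ℕ.+ 2) cn)
    upper = subst₂ (λ b′ t′ → RankIn K b′ (stackCount b′ t′) (stackCount b′ (suc t′)) (Y (I ℕ.+ 2) cn))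
                   (parity-+2ˡ I cn) (blockIndex-next e k)
                   (Y-rank (blockCell e′ k′ i′ next-row (1≤i′ , i′≤m , cn∈[1,n]) t′≤))

  Y-column : ∀ I → 1 ℕ.≤ I → I ℕ.+ 2 ℕ.≤ m ℕ.* r → Ordered (parity (I ℕ.+ cn)) (Y I cn) (Y (I ℕ.+ 2) cn)
  Y-column I 1≤I I+2≤mr with decode (1≤I , ℕₚ.≤-trans (ℕₚ.m≤m+n I 2) I+2≤mr , cn∈[1,n])
  ... | blockCell e k i refl (1≤i , i≤m , _) t≤ with i ℕ.+ 2 ℕ.≤? m
  ... | yes i+2≤m = within-block e k i 1≤i i+2≤m t≤
  ... | no  i+2≰m = across-blocks e k i 1≤i i≤m (ℕₚ.≰⇒> i+2≰m) t≤ I+2≤mr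

  center-stack : center (m ℕ.* r) ≡ c ℕ.* m ℕ.+ center m
  center-stack with m≡suc[h*2]
  ... | h , refl = begin
      center (suc (h ℕ.* 2) ℕ.* r)                  ≡⟨ cong center (spread h c) ⟩
      center (suc ((c ℕ.* suc (h ℕ.* 2) ℕ.+ h) ℕ.* 2)) ≡⟨ center-odd _ ⟩
      suc (c ℕ.* suc (h ℕ.* 2) ℕ.+ h)                ≡⟨ sym (ℕₚ.+-suc _ h) ⟩
      c ℕ.* suc (h ℕ.* 2) ℕ.+ suc h                  ≡⟨ cong (c ℕ.* suc (h ℕ.* 2) ℕ.+_) (sym (center-odd h)) ⟩
      c ℕ.* suc (h ℕ.* 2) ℕ.+ center (suc (h ℕ.* 2)) ∎
    where
    open ≡-Reasoning
    spread : ∀ h c → suc (h ℕ.* 2) ℕ.* suc (c ℕ.* 2) ≡ suc ((c ℕ.* suc (h ℕ.* 2) ℕ.+ h) ℕ.* 2)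
    spread = ℕ-Ring.solve-∀

  Y-row : ∀ j → 1 ℕ.≤ j → j ℕ.+ 2 ℕ.≤ n →
    Ordered (parity (center (m ℕ.* r) ℕ.+ j)) (Y (center (m ℕ.* r)) j) (Y (center (m ℕ.* r)) (j ℕ.+ 2))
  Y-row j 1≤j j+2≤n with blockIndex-surjective c
  ... | e , k , c≡ =
    subst (λ C → Ordered (parity (C ℕ.+ j)) (Y C j) (Y C (j ℕ.+ 2)))
          (sym (trans center-stack (cong (λ t → t ℕ.* m ℕ.+ cm) c≡)))
          (Y-ordered e k (proj₁ cm∈[1,m] , proj₂ cm∈[1,m] , 1≤j , ℕₚ.≤-trans (ℕₚ.m≤m+n j 2) j+2≤n)
                         (proj₁ cm∈[1,m] , proj₂ cm∈[1,m] , ℕₚ.≤-trans 1≤j (ℕₚ.m≤m+n j 2) , j+2≤n)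
                         (subst (ℕ._≤ c ℕ.* 2) c≡ (ℕₚ.m≤m*n c 2))
                         (parity-+2ʳ cm j) (row j 1≤j j+2≤n))
    where
    cm : ℕ
    cm = center m
    cm∈[1,m] : 1 ℕ.≤ cm × cm ℕ.≤ m
    cm∈[1,m] = center-bounds m m-odd

  stack-area : m ℕ.* r ℕ.* n ≡ 3 ℕ.+ W ℕ.* 2
  stack-area = begin
      m ℕ.* r ℕ.* n         ≡⟨ swap m r n ⟩
      m ℕ.* n ℕ.* r         ≡⟨ cong (ℕ._* r) area ⟩
      (3 ℕ.+ v ℕ.* 2) ℕ.* r ≡⟨ spread v c ⟩
      3 ℕ.+ W ℕ.* 2         ∎
    where
    open ≡-Reasoning
    swap : ∀ m r n → m ℕ.* r ℕ.* n ≡ m ℕ.* n ℕ.* r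
    swap = ℕ-Ring.solve-∀
    spread : ∀ v c → (3 ℕ.+ v ℕ.* 2) ℕ.* suc (c ℕ.* 2) ≡ 3 ℕ.+ (c ℕ.* (3 ℕ.+ v ℕ.* 2) ℕ.+ v) ℕ.* 2
    spread = ℕ-Ring.solve-∀

  bicentral : Bicentral K (m ℕ.* r) n W Y
  bicentral = record
    { area    = stack-area
    ; face    = Y-face
    ; ranked  = Y-range
    ; onto    = Y-onto
    ; balance = Y-balance
    ; column  = Y-column
    ; row     = Y-row
    }

open import Data.Nat using (_≤_; _*_)

theorem38 : (m n M N : ℕ) → IsOdd m → IsOdd n → IsOdd M → IsOdd N →
    3 ≤ m → 3 ≤ n → m ≤ M → n ≤ N →
    (X : Label) → PBB M N m n X →
    ((r : ℕ) → IsOdd r → m * r ≤ M →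
       (Y : Label) → IsHASC M N m n r X Y → PBB M N (m * r) n Y)
    × ((r : ℕ) → IsOdd r → n * r ≤ N →
       (Y : Label) → IsVASC M N m n r X Y → PBB M N m (n * r) Y)
theorem38 m n M N m-odd n-odd _ _ m≥3 n≥3 m≤M n≤N X pbb with PBB⇒Bicentral pbb
... | v , B = horizontal , vertical
  where
  m-parity : parity m ≡ 1ℙ
  m-parity = odd⇒parity≡1ℙ m m-odd
  n-parity : parity n ≡ 1ℙ
  n-parity = odd⇒parity≡1ℙ n n-odd

  horizontal : (r : ℕ) → IsOdd r → m * r ≤ M → (Y : Label) → IsHASC M N m n r X Y → PBB M N (m * r) n Y
  horizontal r r-odd mr≤M Y hasc with parity≡1ℙ⇒suc[h*2] r (odd⇒parity≡1ℙ r r-odd)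
  ... | c , refl =
    Bicentral⇒PBB (parity≡1ℙ⇒odd (m * r) (parity[odd*odd]≡1ℙ m r m-odd r-odd)) n-odd
                  (ℕₚ.≤-trans m≥3 (ℕₚ.m≤m*n m r)) n≥3 mr≤M n≤N
                  (Stacking.bicentral B m-parity n-parity m≥3 c (IsHASC⇒BlockStack M N (Bicentral.area B) c X Y hasc))

  vertical : (r : ℕ) → IsOdd r → n * r ≤ N → (Y : Label) → IsVASC M N m n r X Y → PBB M N m (n * r) Y
  vertical r r-odd nr≤N Y vasc with parity≡1ℙ⇒suc[h*2] r (odd⇒parity≡1ℙ r r-odd)
  ... | c , refl =
    Bicentral⇒PBB m-odd (parity≡1ℙ⇒odd (n * r) (parity[odd*odd]≡1ℙ n r n-odd r-odd))
                  m≥3 (ℕₚ.≤-trans n≥3 (ℕₚ.m≤m*n n r)) m≤M nr≤N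
                  (Bicentral-transpose (Stacking.bicentral (Bicentral-transpose B) n-parity m-parity n≥3 c
                                                           (IsVASC⇒BlockStack M N (Bicentral.area B) c X Y vasc)))
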